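{- Let $w$ be an oriented maximal Wicks form of genus $g$, and let $w'$ be obtained from $w$ by an IH-transformation on some edge $x$. Then: (i) $w'$ is again an oriented maximal Wicks form of genus $g$; (ii) if the IH-transformation is of type 2 (type 2a or type 2b), then $w'$ is equivalent (isomorphic) to $w$.
   Context: An oriented Wicks form is a cyclic word $w$ over an alphabet $a_1^{\pm1},a_2^{\pm1},\dots$ such that: (1) if $a_i^{\epsilon}$ appears, then $a_i^{ -\epsilon}$ appears exactly once; (2) there is no cyclic factor $a_ia_i^{ -1}$ or $a_i^{ -1}a_i$; (3) if $a_i^{\epsilon}a_j^{\delta}$ is a cyclic factor, then $a_j^{ -\delta}a_i^{ -\epsilon}$ is not. Two forms are equivalent (isomorphic) if they agree as cyclic words after a bijection $\varphi$ of alphabets with $\varphi(a^{ -1})=\varphi(a)^{ -1}$. The genus is the genus of the closed oriented surface obtained by gluing a polygon labelled by $w$. The form is maximal if its length is $6(2g-1)$. IH-transformation: let $w$ be an oriented maximal Wicks form and $x$ a letter of it. Let $axb$ and $cx^{ -1}d$ be the cyclic factors of $w$ around $x$ and $x^{ -1}$, where $a,b,c,d$ are letters. One always has $b\ne a^{ -1}$, $c\ne b^{ -1}$, $d\ne a^{ -1}$, $d\ne c^{ -1}$ and $(c,d)\ne(a^{ -1},b^{ -1})$. Let $y$ be a new letter. - Type 1: $c\neq a^{ -1}$ and $d\neq b^{ -1}$. Then $d^{ -1}a^{ -1}$ and $b^{ -1}c^{ -1}$ are cyclic factors of $w$. The transformation replaces $axb\mapsto ab$, $cx^{ -1}d\mapsto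 cd$, $d^{ -1}a^{ -1}\mapsto d^{ -1}ya^{ -1}$ and $b^{ -1}c^{ -1}\mapsto b^{ -1}y^{ -1}c^{ -1}$. - Type 2a: $c=a^{ -1}$. Then $b^{ -1}axb$ and $d^{ -1}a^{ -1}x^{ -1}d$ are cyclic factors. The transformation replaces them by $b^{ -1}yab$ and $d^{ -1}y^{ -1}a^{ -1}d$. - Type 2b: $d=b^{ -1}$. Then $axba^{ -1}$ and $cx^{ -1}b^{ -1}c^{ -1}$ are cyclic factors. The transformation replaces them by $abya^{ -1}$ and $cb^{ -1}y^{ -1}c^{ -1}$. -}

module Defs where

open import Data.Nat using (ℕ; zero; suc; _+_; _*_; _∸_)
import Data.Nat as ℕ
open import Data.Bool using (Bool; true; false; not)
import Data.Bool as 𝔹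
open import Data.Product using (_×_; _,_; ∃; ∃-syntax; Σ)
open import Data.Product.Properties using (≡-dec)
open import Data.Sum using (_⊎_)
open import Data.List using (List; []; _∷_; _++_; length; filter; lookup; map)
open import Data.List.Membership.Propositional using (_∈_; _∉_)
open import Data.Fin using (Fin; toℕ)
open import Relation.Binary.PropositionalEquality using (_≡_; _≢_)
open import Relation.Binary.Definitions using (DecidableEquality)
open import Relation.Binary.Construct.Closure.Equivalence using (EqClosure)
open import Relation.Nullary using (¬_)
open import Function.Definitions using (Injective)

-- Letters: a_i^{+1} is (i , true), a_i^{-1} is (i , false).

Letter : Set
Letter = ℕ × Bool

_≟L_ : DecidableEquality Letter
_≟L_ = ≡-dec ℕ._≟_ 𝔹._≟_

inv : Letter → Letter
inv (i , s) = (i , not s)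

-- A cyclic word is represented by a list (any of its linear readings);
-- all notions below are invariant under rotation.
Word : Set
Word = List Letter

Rot : Word → Word → Set
Rot w w' = ∃[ p ] ∃[ s ] (w ≡ p ++ s × w' ≡ s ++ p)

CycFactor : Word → Word → Set
CycFactor u w = ∃[ r ] ∃[ t ] (Rot w r × r ≡ u ++ t)

occ : Letter → Word → ℕ
occ l w = length (filter (_≟L l) w)

record IsWicks (w : Word) : Set where
  field
    inverse-once : ∀ l → l ∈ w → occ (inv l) w ≡ 1
    no-cancel    : ∀ l → ¬ CycFactor (l ∷ inv l ∷ []) w
    no-inv-pair  : ∀ l m → CycFactor (l ∷ m ∷ []) w →
                   ¬ CycFactor (inv m ∷ inv l ∷ []) w

-- Genus of the surface obtained by gluing the polygon labelled by w.
-- Corners of the polygon are indexed by positions k : Fin n (corner k is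
-- the initial vertex of the k-th side; side k runs from corner k to corner
-- k+1 mod n).  If the sides i and j carry mutually inverse letters, they
-- are glued with opposite orientation, identifying corner i with corner
-- j+1 (mod n) (and corner i+1 with corner j, which is the same rule read
-- from side j).

IsSucMod : ∀ {n} → Fin n → Fin n → Set
IsSucMod {n} j l = (toℕ l ≡ suc (toℕ j)) ⊎ (toℕ l ≡ 0 × suc (toℕ j) ≡ n)

CornerGlue : (w : Word) → Fin (length w) → Fin (length w) → Set
CornerGlue w k l =
  ∃[ j ] (lookup w k ≡ inv (lookup w j) × IsSucMod j l)

SameVertex : (w : Word) → Fin (length w) → Fin (length w) → Set
SameVertex w = EqClosure (CornerGlue w)

HasVertices : Word → ℕ → Set
HasVertices w V =
  Σ (Fin (length w) → Fin V) λ cls →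
    (∀ v → ∃[ k ] cls k ≡ v) ×
    (∀ k l → cls k ≡ cls l → SameVertex w k l) ×
    (∀ k l → SameVertex w k l → cls k ≡ cls l)

-- genus g: Euler characteristic V - E + F = 2 - 2g with E = n/2, F = 1,
-- i.e. 2V + 4g = n + 2
HasGenus : Word → ℕ → Set
HasGenus w g = ∃[ V ] (HasVertices w V × 2 * V + 4 * g ≡ length w + 2)

MaxWicks : ℕ → Word → Set
MaxWicks g w = IsWicks w × HasGenus w g × length w ≡ 6 * (2 * g ∸ 1)

Equivalent : Word → Word → Set
Equivalent w w' =
  Σ (Letter → Letter) λ φ →
    Injective _≡_ _≡_ φ × (∀ l → φ (inv l) ≡ inv (φ l)) × Rot w (map φ w')

Replace : Word → Word → Word → Word → Set
Replace u v w w' = ∃[ r ] (Rot w (u ++ r) × Rot w' (v ++ r))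

Fresh : Letter → Word → Set
Fresh y w = y ∉ w × inv y ∉ w

IHType1 : Word → Letter → Letter → Word → Set
IHType1 w x y w' =
  ∃[ a ] ∃[ b ] ∃[ c ] ∃[ d ] ∃[ w₁ ] ∃[ w₂ ] ∃[ w₃ ]
    ( CycFactor (a ∷ x ∷ b ∷ []) w
    × CycFactor (c ∷ inv x ∷ d ∷ []) w
    × c ≢ inv a × d ≢ inv b
    × Replace (a ∷ x ∷ b ∷ []) (a ∷ b ∷ []) w w₁
    × Replace (c ∷ inv x ∷ d ∷ []) (c ∷ d ∷ []) w₁ w₂
    × Replace (inv d ∷ inv a ∷ []) (inv d ∷ y ∷ inv a ∷ []) w₂ w₃
    × Replace (inv b ∷ inv c ∷ []) (inv b ∷ inv y ∷ inv c ∷ []) w₃ w' )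

IHType2a : Word → Letter → Letter → Word → Set
IHType2a w x y w' =
  ∃[ a ] ∃[ b ] ∃[ d ] ∃[ w₁ ]
    ( CycFactor (a ∷ x ∷ b ∷ []) w
    × CycFactor (inv a ∷ inv x ∷ d ∷ []) w
    × Replace (inv b ∷ a ∷ x ∷ b ∷ []) (inv b ∷ y ∷ a ∷ b ∷ []) w w₁
    × Replace (inv d ∷ inv a ∷ inv x ∷ d ∷ [])
              (inv d ∷ inv y ∷ inv a ∷ d ∷ []) w₁ w' )

IHType2b : Word → Letter → Letter → Word → Set
IHType2b w x y w' =
  ∃[ a ] ∃[ b ] ∃[ c ] ∃[ w₁ ]
    ( CycFactor (a ∷ x ∷ b ∷ []) w
    × CycFactor (c ∷ inv x ∷ inv b ∷ []) w
    × Replace (a ∷ x ∷ b ∷ inv a ∷ []) (a ∷ b ∷ y ∷ inv a ∷ []) w w₁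
    × Replace (c ∷ inv x ∷ inv b ∷ inv c ∷ [])
              (c ∷ inv b ∷ inv y ∷ inv c ∷ []) w₁ w' )

IHType2 : Word → Letter → Letter → Word → Set
IHType2 w x y w' = IHType2a w x y w' ⊎ IHType2b w x y w'

IH : Word → Letter → Letter → Word → Set
IH w x y w' = IHType1 w x y w' ⊎ IHType2 w x y w'

{-# OPTIONS --safe #-}
module Submission where

-- Label the corner where side m of the polygon starts by the letter m; the gluing identifies it with
-- the corner where the side following m⁻¹ starts. An IH-transformation trades the edge x for a fresh
-- edge y, so it keeps the length, and the Wicks conditions only need checking at the few adjacencies
-- it creates. The genus is then fixed by the number of vertices. A type 1 transformation only regroups
-- the corners of the two vertices at the ends of x, so the vertices of w and w′ still correspond.
-- A type 2a transformation is the relabelling a ↦ y ↦ x ↦ a (b ↦ y ↦ x ↦ b for type 2b): it carries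
-- every adjacency of w to one of w′, and a cyclic word without repeated letters is determined by its
-- adjacencies.

open import Defs
open import Data.Bool using (true; false)
open import Data.Bool.Properties using (not-involutive)
open import Data.Empty using (⊥-elim)
open import Data.Fin using (Fin; toℕ) renaming (zero to fzero; suc to fsuc)
open import Data.List using (List; []; _∷_; _++_; [_]; length; filter; lookup; map; take)
open import Data.List.Properties
  using (length-++; filter-++; ++-assoc; ++-identityʳ; map-++; length-map; ∷-injective; ∷ʳ-injective)
open import Data.List.Membership.Propositional using (_∈_; _∉_)
open import Data.List.Membership.Propositional.Properties using (∈-lookup; ∈-∃++)
open import Data.List.Membership.DecPropositional _≟L_ using (_∈?_)
open import Data.List.Relation.Unary.Any using (here; there; index)
open import Data.List.Relation.Unary.Any.Properties using (lookup-index)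
open import Data.Nat using (ℕ; zero; suc; _+_; _≤_; z≤n; s≤s)
open import Data.Nat.Properties
  using (+-suc; +-comm; +-assoc; +-identityʳ; +-cancelʳ-≡; suc-injective; 0≢1+n; <-irrefl; ≤-trans; ≤-reflexive)
open import Data.Nat.Solver using (module +-*-Solver)
open import Data.Product using (_×_; _,_; ∃₂; ∃-syntax; proj₁; proj₂)
open import Data.Sum using (_⊎_; inj₁; inj₂)
open import Function using (_∘_)
open import Function.Definitions using (Injective)
open import Relation.Binary.Construct.Closure.Equivalence using (EqClosure; symmetric)
open import Relation.Binary.Construct.Closure.ReflexiveTransitive using (ε; _◅_; _◅◅_)
open import Relation.Binary.Construct.Closure.Symmetric using (fwd; bwd)
open import Relation.Binary.PropositionalEquality hiding ([_])
open import Relation.Nullary using (¬_; Dec; yes; no)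

open +-*-Solver

-- Letters and their occurrences

inv-involutive : ∀ l → inv (inv l) ≡ l
inv-involutive (i , s) = cong (i ,_) (not-involutive s)

≢-inv : ∀ l → l ≢ inv l
≢-inv (i , true) ()
≢-inv (i , false) ()

inv-injective : ∀ {l m} → inv l ≡ inv m → l ≡ m
inv-injective {l} {m} e = trans (sym (inv-involutive l)) (trans (cong inv e) (inv-involutive m))

inv-moveˡ : ∀ {l m} → l ≡ inv m → inv l ≡ m
inv-moveˡ {l} {m} e = trans (cong inv e) (inv-involutive m)

inv-moveʳ : ∀ {l m} → inv l ≡ m → l ≡ inv m
inv-moveʳ e = sym (inv-moveˡ (sym e))

≡inv-sym : ∀ {m p} → p ≡ inv m → m ≡ inv p
≡inv-sym e = sym (inv-moveˡ e)

δ : Letter → Letter → ℕ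
δ l p = occ l [ p ]

occ-∷ : ∀ l p t → occ l (p ∷ t) ≡ δ l p + occ l t
occ-∷ l p t with p ≟L l
... | yes _ = refl
... | no _ = refl

δ-refl : ∀ l → δ l l ≡ 1
δ-refl l with l ≟L l
... | yes _ = refl
... | no l≢l = ⊥-elim (l≢l refl)

δ-≢ : ∀ {l p} → p ≢ l → δ l p ≡ 0
δ-≢ {l} {p} p≢l with p ≟L l
... | yes p≡l = ⊥-elim (p≢l p≡l)
... | no _ = refl

occ-++ : ∀ l A B → occ l (A ++ B) ≡ occ l A + occ l B
occ-++ l A B = trans (cong length (filter-++ (_≟L l) A B)) (length-++ (filter (_≟L l) A))

∈⇒occ-suc : ∀ {l w} → l ∈ w → ∃[ k ] occ l w ≡ suc k
∈⇒occ-suc {l} {z ∷ w} (here refl) rewrite occ-∷ l l w | δ-refl l = occ l w , refl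
∈⇒occ-suc {l} {z ∷ w} (there l∈w) with ∈⇒occ-suc l∈w
... | k , e rewrite occ-∷ l z w | e = δ l z + k , +-suc (δ l z) k

∉⇒occ≡0 : ∀ {l w} → l ∉ w → occ l w ≡ 0
∉⇒occ≡0 {l} {[]} l∉w = refl
∉⇒occ≡0 {l} {z ∷ w} l∉w rewrite occ-∷ l z w | δ-≢ {l} {z} (λ e → l∉w (here (sym e))) =
  ∉⇒occ≡0 (λ l∈w → l∉w (there l∈w))

occ-suc⇒∈ : ∀ {l w k} → occ l w ≡ suc k → l ∈ w
occ-suc⇒∈ {l} {[]} ()
occ-suc⇒∈ {l} {z ∷ w} {k} e = by-cases (z ≟L l) (trans (sym (occ-∷ l z w)) e)
  where
  by-cases : Dec (z ≡ l) → δ l z + occ l w ≡ suc k → l ∈ z ∷ w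
  by-cases (yes refl) _ = here refl
  by-cases (no z≢l) e′ = there (occ-suc⇒∈ {l} {w} {k} (trans (cong (_+ occ l w) (sym (δ-≢ z≢l))) e′))

occ≡0⇒∉ : ∀ {l w} → occ l w ≡ 0 → l ∉ w
occ≡0⇒∉ e l∈w with ∈⇒occ-suc l∈w
... | k , e′ = 0≢1+n (trans (sym e) e′)

∈∧∉⇒≢ : ∀ {a b : Letter} {w} → a ∈ w → b ∉ w → a ≢ b
∈∧∉⇒≢ a∈w b∉w refl = b∉w a∈w

-- Unlike occ, occS unfolds on a list of variables into a sum of δ's, ready for the ring solver.
occS : Letter → Word → ℕ
occS l [] = 0
occS l (p ∷ t) = δ l p + occS l t

occ≡occS : ∀ l t → occ l t ≡ occS l t
occ≡occS l [] = refl
occ≡occS l (p ∷ t) = trans (occ-∷ l p t) (cong (δ l p +_) (occ≡occS l t))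

+-rebalance : ∀ W W′ V U X Y → W + V ≡ W′ + U → V + X ≡ U + Y → W′ + X ≡ W + Y
+-rebalance W W′ V U X Y e₁ e₂ = +-cancelʳ-≡ U (W′ + X) (W + Y) (begin
  (W′ + X) + U  ≡⟨ solve 3 (λ a b c → (a :+ b) :+ c := (a :+ c) :+ b) refl W′ X U ⟩
  (W′ + U) + X  ≡⟨ cong (_+ X) (sym e₁) ⟩
  (W + V) + X   ≡⟨ +-assoc W V X ⟩
  W + (V + X)   ≡⟨ cong (W +_) e₂ ⟩
  W + (U + Y)   ≡⟨ solve 3 (λ a b c → a :+ (b :+ c) := (a :+ c) :+ b) refl W U Y ⟩
  (W + Y) + U   ∎)
  where open ≡-Reasoning

occ-trade : ∀ w w′ x y U V → (∀ l → occ l w + occ l V ≡ occ l w′ + occ l U) →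
            (∀ l → occS l V + (δ l x + δ l (inv x)) ≡ occS l U + (δ l y + δ l (inv y))) →
            ∀ l → occ l w′ + (δ l x + δ l (inv x)) ≡ occ l w + (δ l y + δ l (inv y))
occ-trade w w′ x y U V replaced balance l = +-rebalance (occ l w) (occ l w′) (occS l V) (occS l U) _ _
  (subst₂ (λ V′ U′ → occ l w + V′ ≡ occ l w′ + U′) (occ≡occS l V) (occ≡occS l U) (replaced l)) (balance l)

Distinct : Word → Set
Distinct w = ∀ l → l ∈ w → occ l w ≡ 1

InvClosed : Word → Set
InvClosed w = ∀ l → l ∈ w → inv l ∈ w

Distinct-head : ∀ {z t} → Distinct (z ∷ t) → z ∉ t
Distinct-head {z} {t} dist z∈t with ∈⇒occ-suc z∈t
... | k , e = 0≢1+n (sym (suc-injective (begin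
    suc (suc k)        ≡⟨ cong suc (sym e) ⟩
    suc (occ z t)      ≡⟨ cong (_+ occ z t) (sym (δ-refl z)) ⟩
    δ z z + occ z t    ≡⟨ sym (occ-∷ z z t) ⟩
    occ z (z ∷ t)      ≡⟨ dist z (here refl) ⟩
    1                  ∎)))
  where open ≡-Reasoning

Distinct-tail : ∀ {z t} → Distinct (z ∷ t) → Distinct t
Distinct-tail {z} {t} dist l l∈t with ∈⇒occ-suc l∈t | trans (sym (occ-∷ l z t)) (dist l (there l∈t))
... | k , e | e₁ rewrite e with δ l z
... | zero = e₁
... | suc j = ⊥-elim (0≢1+n (sym (suc-injective (trans (sym (+-suc (suc j) k)) e₁))))

-- Adjacency, rotation and replacement

data Adj : Word → Letter → Letter → Set where
  hd : ∀ {p q t} → Adj (p ∷ q ∷ t) p q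
  tl : ∀ {z t p q} → Adj t p q → Adj (z ∷ t) p q

Adj-++ˡ : ∀ {A p q} B → Adj A p q → Adj (A ++ B) p q
Adj-++ˡ B hd = hd
Adj-++ˡ B (tl a) = tl (Adj-++ˡ B a)

Adj-++ʳ : ∀ A {B p q} → Adj B p q → Adj (A ++ B) p q
Adj-++ʳ [] a = a
Adj-++ʳ (z ∷ A) a = tl (Adj-++ʳ A a)

Adj-infix : ∀ A {p q B} → Adj (A ++ p ∷ q ∷ B) p q
Adj-infix A = Adj-++ʳ A hd

Straddles : Word → Word → Letter → Letter → Set
Straddles A B p q = (∃[ A′ ] A ≡ A′ ++ [ p ]) × (∃[ B′ ] B ≡ q ∷ B′)

Adj-++⁻ : ∀ A B {p q} → Adj (A ++ B) p q → Adj A p q ⊎ Adj B p q ⊎ Straddles A B p q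
Adj-++⁻ [] B a = inj₂ (inj₁ a)
Adj-++⁻ (z ∷ []) (q ∷ B) hd = inj₂ (inj₂ (([] , refl) , (B , refl)))
Adj-++⁻ (z ∷ []) B (tl a) = inj₂ (inj₁ a)
Adj-++⁻ (z ∷ z′ ∷ A) B hd = inj₁ hd
Adj-++⁻ (z ∷ z′ ∷ A) B (tl a) with Adj-++⁻ (z′ ∷ A) B a
... | inj₁ a′ = inj₁ (tl a′)
... | inj₂ (inj₁ b) = inj₂ (inj₁ b)
... | inj₂ (inj₂ ((A′ , e) , st)) = inj₂ (inj₂ ((z ∷ A′ , cong (z ∷_) e) , st))

Adj⇒∈ : ∀ {X p q} → Adj X p q → p ∈ X × q ∈ X
Adj⇒∈ hd = here refl , there (here refl)
Adj⇒∈ (tl a) = there (proj₁ (Adj⇒∈ a)) , there (proj₂ (Adj⇒∈ a))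

Adj⇒infix : ∀ {X p q} → Adj X p q → ∃[ A ] ∃[ B ] X ≡ A ++ p ∷ q ∷ B
Adj⇒infix {p ∷ q ∷ t} hd = [] , t , refl
Adj⇒infix {z ∷ t} (tl a) with Adj⇒infix a
... | A , B , refl = z ∷ A , B , refl

Adj-∷⇒snd∈ : ∀ {z Y p q} → Adj (z ∷ Y) p q → q ∈ Y
Adj-∷⇒snd∈ hd = here refl
Adj-∷⇒snd∈ (tl a) = proj₂ (Adj⇒∈ a)

¬Adj-[_] : ∀ z {p q} → ¬ Adj [ z ] p q
¬Adj-[ z ] (tl ())

∈-∷ʳ : ∀ (A : Word) {p} → p ∈ A ++ [ p ]
∈-∷ʳ [] = here refl
∈-∷ʳ (z ∷ A) = there (∈-∷ʳ A)

Adj-∷ʳ⇒fst∈ : ∀ Y {z p q} → Adj (Y ++ [ z ]) p q → p ∈ Y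
Adj-∷ʳ⇒fst∈ Y a with Adj-++⁻ Y _ a
... | inj₁ a′ = proj₁ (Adj⇒∈ a′)
... | inj₂ (inj₁ a′) = ⊥-elim (¬Adj-[ _ ] a′)
... | inj₂ (inj₂ ((A′ , refl) , _)) = ∈-∷ʳ A′

Adj-pair : ∀ {a b p q} → Adj (a ∷ b ∷ []) p q → p ≡ a × q ≡ b
Adj-pair hd = refl , refl
Adj-pair (tl (tl ()))

Adj-triple : ∀ {a b c p q} → Adj (a ∷ b ∷ c ∷ []) p q → (p ≡ a × q ≡ b) ⊎ (p ≡ b × q ≡ c)
Adj-triple hd = inj₁ (refl , refl)
Adj-triple (tl a) = inj₂ (Adj-pair a)

Adj-quadruple : ∀ {a b c d p q} → Adj (a ∷ b ∷ c ∷ d ∷ []) p q →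
                (p ≡ a × q ≡ b) ⊎ (p ≡ b × q ≡ c) ⊎ (p ≡ c × q ≡ d)
Adj-quadruple hd = inj₁ (refl , refl)
Adj-quadruple (tl a) = inj₂ (Adj-triple a)

Rot-sym : ∀ {w w′} → Rot w w′ → Rot w′ w
Rot-sym (P , S , e , e′) = S , P , e′ , e

++-overlap : ∀ (P S P′ S′ : Word) → P ++ S ≡ P′ ++ S′ →
             (∃[ M ] (P ≡ P′ ++ M × S′ ≡ M ++ S)) ⊎ (∃[ M ] (P′ ≡ P ++ M × S ≡ M ++ S′))
++-overlap [] S P′ S′ e = inj₂ (P′ , refl , e)
++-overlap (z ∷ P) S [] S′ e = inj₁ (z ∷ P , refl , sym e)
++-overlap (z ∷ P) S (z′ ∷ P′) S′ e with ∷-injective e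
... | refl , e′ with ++-overlap P S P′ S′ e′
... | inj₁ (M , e₁ , e₂) = inj₁ (M , cong (z ∷_) e₁ , e₂)
... | inj₂ (M , e₁ , e₂) = inj₂ (M , cong (z ∷_) e₁ , e₂)

Rot-trans : ∀ {u v w} → Rot u v → Rot v w → Rot u w
Rot-trans (P , S , refl , refl) (P′ , S′ , e , refl) with ++-overlap S P P′ S′ e
... | inj₁ (M , refl , refl) = P ++ P′ , M , sym (++-assoc P P′ M) , ++-assoc M P P′
... | inj₂ (M , refl , refl) = M , S′ ++ S , ++-assoc M S′ S , sym (++-assoc S′ S M)

Rot-++-∷ : ∀ A p B → Rot (A ++ p ∷ B) (p ∷ B ++ A)
Rot-++-∷ A p B = A , p ∷ B , refl , refl

module Additive (μ : Word → ℕ) (μ-++ : ∀ A B → μ (A ++ B) ≡ μ A + μ B) where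

  μ-Rot : ∀ {w w′} → Rot w w′ → μ w ≡ μ w′
  μ-Rot (P , S , refl , refl) = trans (μ-++ P S) (trans (+-comm (μ P) (μ S)) (sym (μ-++ S P)))

  μ-Replace : ∀ {u v w w′} → Replace u v w w′ → μ w + μ v ≡ μ w′ + μ u
  μ-Replace {u} {v} (r , R , R′) rewrite μ-Rot R | μ-Rot R′ | μ-++ u r | μ-++ v r =
    solve 3 (λ u r v → (u :+ r) :+ v := (v :+ r) :+ u) refl (μ u) (μ r) (μ v)

  μ-chain : ∀ {w₀ w₁ w₂ u₁ v₁ u₂ v₂} → μ w₀ + μ v₁ ≡ μ w₁ + μ u₁ → μ w₁ + μ v₂ ≡ μ w₂ + μ u₂ →
            μ w₀ + μ (v₁ ++ v₂) ≡ μ w₂ + μ (u₁ ++ u₂)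
  μ-chain {w₀} {w₁} {w₂} {u₁} {v₁} {u₂} {v₂} e₁ e₂ rewrite μ-++ v₁ v₂ | μ-++ u₁ u₂ =
    +-cancelʳ-≡ (μ w₁) _ _ (begin
      μ w₀ + (μ v₁ + μ v₂) + μ w₁    ≡⟨ solve 4 (λ a v₁ v₂ b → a :+ (v₁ :+ v₂) :+ b := (a :+ v₁) :+ (b :+ v₂))
                                              refl (μ w₀) (μ v₁) (μ v₂) (μ w₁) ⟩
      (μ w₀ + μ v₁) + (μ w₁ + μ v₂)  ≡⟨ cong₂ _+_ e₁ e₂ ⟩
      (μ w₁ + μ u₁) + (μ w₂ + μ u₂)  ≡⟨ solve 4 (λ b u₁ c u₂ → (b :+ u₁) :+ (c :+ u₂) := c :+ (u₁ :+ u₂) :+ b)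
                                              refl (μ w₁) (μ u₁) (μ w₂) (μ u₂) ⟩
      μ w₂ + (μ u₁ + μ u₂) + μ w₁    ∎)
    where open ≡-Reasoning

  μ-Replace₂ : ∀ {w₀ w₁ w₂ u₁ v₁ u₂ v₂} → Replace u₁ v₁ w₀ w₁ → Replace u₂ v₂ w₁ w₂ →
               μ w₀ + μ (v₁ ++ v₂) ≡ μ w₂ + μ (u₁ ++ u₂)
  μ-Replace₂ {w₀} {w₁} {w₂} {u₁} {v₁} {u₂} {v₂} R R′ =
    μ-chain {w₀} {w₁} {w₂} {u₁} {v₁} {u₂} {v₂} (μ-Replace R) (μ-Replace R′)

  μ-Replace₄ : ∀ {w₀ w₁ w₂ w₃ w₄ u₁ v₁ u₂ v₂ u₃ v₃ u₄ v₄} →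
               Replace u₁ v₁ w₀ w₁ → Replace u₂ v₂ w₁ w₂ → Replace u₃ v₃ w₂ w₃ → Replace u₄ v₄ w₃ w₄ →
               μ w₀ + μ ((v₁ ++ v₂) ++ (v₃ ++ v₄)) ≡ μ w₄ + μ ((u₁ ++ u₂) ++ (u₃ ++ u₄))
  μ-Replace₄ {w₀} {w₁} {w₂} {w₃} {w₄} {u₁} {v₁} {u₂} {v₂} {u₃} {v₃} {u₄} {v₄} R₁ R₂ R₃ R₄ =
    μ-chain {w₀} {w₂} {w₄} {u₁ ++ u₂} {v₁ ++ v₂} {u₃ ++ u₄} {v₃ ++ v₄} (μ-Replace₂ R₁ R₂) (μ-Replace₂ R₃ R₄)

module Length = Additive length (λ A B → length-++ A)
module Occ (l : Letter) = Additive (occ l) (occ-++ l)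

occ-Rot : ∀ {w w′} → Rot w w′ → ∀ l → occ l w ≡ occ l w′
occ-Rot R l = Occ.μ-Rot l R

∈-Rot : ∀ {w w′} → Rot w w′ → ∀ {l} → l ∈ w → l ∈ w′
∈-Rot R {l} l∈w with ∈⇒occ-suc l∈w
... | k , e = occ-suc⇒∈ (trans (sym (occ-Rot R l)) e)

Distinct-Rot : ∀ {w w′} → Rot w w′ → Distinct w → Distinct w′
Distinct-Rot R dist l l∈w′ = trans (sym (occ-Rot R l)) (dist l (∈-Rot (Rot-sym R) l∈w′))

CycFactor-Rot : ∀ {u w w′} → Rot w w′ → CycFactor u w → CycFactor u w′
CycFactor-Rot R (r , t , R′ , e) = r , t , Rot-trans (Rot-sym R) R′ , e

CycAdj : Letter → Letter → Word → Set
CycAdj p q w = CycFactor (p ∷ q ∷ []) w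

CycFactor⇒CycAdj : ∀ {p q u w} → CycFactor (p ∷ q ∷ u) w → CycAdj p q w
CycFactor⇒CycAdj {u = u} (r , t , R , e) = r , u ++ t , R , e

CycFactor-tail : ∀ {p u w} → CycFactor (p ∷ u) w → CycFactor u w
CycFactor-tail {p} {u} (r , t , R , refl) =
  (u ++ t) ++ [ p ] , t ++ [ p ] , Rot-trans R ([ p ] , u ++ t , refl , refl) , ++-assoc u t [ p ]

Adj⇒CycAdj : ∀ {X p q} → Adj X p q → CycAdj p q X
Adj⇒CycAdj {X} {p} {q} a with Adj⇒infix a
... | A , B , refl = p ∷ q ∷ B ++ A , B ++ A , Rot-++-∷ A p (q ∷ B) , refl

CycAdj⇒Adj : ∀ {p q} X → CycAdj p q X → Adj (X ++ take 1 X) p q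
CycAdj⇒Adj {p} {q} X (r , t , (P , [] , refl , refl) , e) rewrite ++-identityʳ P | e = hd
CycAdj⇒Adj {p} {q} X (r , t , (P , s ∷ [] , refl , refl) , e) with ∷-injective e
... | refl , refl = subst (λ Z → Adj Z p q) (sym (++-assoc (q ∷ t) [ p ] [ q ])) (Adj-infix (q ∷ t))
CycAdj⇒Adj {p} {q} X (r , t , (P , s₁ ∷ s₂ ∷ S , refl , refl) , e) with ∷-injective e
... | refl , e′ with ∷-injective e′
... | refl , _ = Adj-++ˡ (take 1 (P ++ p ∷ q ∷ S)) (Adj-infix P)

Adj-closed⇒CycAdj : ∀ {p q} h Y → Y ≢ [] → Adj ((h ∷ Y) ++ [ h ]) p q → CycAdj p q (h ∷ Y)
Adj-closed⇒CycAdj {p} {q} h Y Y≢[] a with Adj-++⁻ (h ∷ Y) [ h ] a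
... | inj₁ a′ = Adj⇒CycAdj a′
... | inj₂ (inj₁ a′) = ⊥-elim (¬Adj-[ h ] a′)
... | inj₂ (inj₂ (([] , e) , _)) = ⊥-elim (Y≢[] (proj₂ (∷-injective e)))
... | inj₂ (inj₂ ((z ∷ A′ , e) , (B′ , refl))) with ∷-injective e
... | refl , _ = p ∷ h ∷ A′ , A′ , (h ∷ A′ , [ p ] , e , refl) , refl

CycAdj-resp : ∀ {p p′ q q′ w} → p ≡ p′ → q ≡ q′ → CycAdj p′ q′ w → CycAdj p q w
CycAdj-resp refl refl c = c

CycAdj-inv²⁺ : ∀ {w p q} → CycAdj p q w → CycAdj (inv (inv p)) (inv (inv q)) w
CycAdj-inv²⁺ = CycAdj-resp (inv-involutive _) (inv-involutive _)

CycAdj-inv²⁻ : ∀ {w p q} → CycAdj (inv (inv p)) (inv (inv q)) w → CycAdj p q w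
CycAdj-inv²⁻ = CycAdj-resp (sym (inv-involutive _)) (sym (inv-involutive _))

CycAdj⇒∈ : ∀ {p q w} → CycAdj p q w → p ∈ w × q ∈ w
CycAdj⇒∈ (r , t , R , refl) = ∈-Rot (Rot-sym R) (here refl) , ∈-Rot (Rot-sym R) (there (here refl))

module _ {w : Word} (dist : Distinct w) where

  CycAdj-functional : ∀ {p q q′} → CycAdj p q w → CycAdj p q′ w → q ≡ q′
  CycAdj-functional {p} {q} c@(r , t , R , refl) c′ with CycAdj⇒Adj (p ∷ q ∷ t) (CycFactor-Rot R c′)
  ... | hd = refl
  ... | tl a = ⊥-elim (Distinct-head (Distinct-Rot R dist) (Adj-∷ʳ⇒fst∈ (q ∷ t) a))

  CycAdj-injective : ∀ {p p′ q} → CycAdj p q w → CycAdj p′ q w → p ≡ p′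
  CycAdj-injective {p} {p′} {q} (r , t , R , refl) c′ =
    last-letter (Adj-++⁻ (q ∷ (t ++ [ p ])) [ q ] (CycAdj⇒Adj (q ∷ (t ++ [ p ])) (CycFactor-Rot R′ c′)))
    where
    R′ : Rot w (q ∷ t ++ [ p ])
    R′ = Rot-trans R ([ p ] , q ∷ t , refl , refl)
    last-letter : Adj (q ∷ (t ++ [ p ])) p′ q ⊎ Adj [ q ] p′ q ⊎ Straddles (q ∷ (t ++ [ p ])) [ q ] p′ q → p ≡ p′
    last-letter (inj₁ a) = ⊥-elim (Distinct-head (Distinct-Rot R′ dist) (Adj-∷⇒snd∈ a))
    last-letter (inj₂ (inj₁ a)) = ⊥-elim (¬Adj-[ q ] a)
    last-letter (inj₂ (inj₂ ((A′ , e) , _))) = proj₂ (∷ʳ-injective (q ∷ t) A′ e)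

  ¬CycAdj-self : ∀ {p} → ¬ CycAdj p p w
  ¬CycAdj-self (r , t , R , refl) = Distinct-head (Distinct-Rot R dist) (here refl)

++-∷-≢-[] : ∀ (A : Word) l B → A ++ l ∷ B ≢ []
++-∷-≢-[] [] l B ()
++-∷-≢-[] (_ ∷ _) l B ()

Replace-sym : ∀ {u v w w′} → Replace u v w w′ → Replace v u w′ w
Replace-sym (r , R , R′) = r , R′ , R

CycAdj-Replace⁺ : ∀ {u v w w′ p q} → Replace u v w w′ → Adj v p q → CycAdj p q w′
CycAdj-Replace⁺ (r , R , R′) a = CycFactor-Rot (Rot-sym R′) (Adj⇒CycAdj (Adj-++ˡ r a))

Inherits : Word → Word → Word → Set
Inherits w′ v w = ∀ {p q} → CycAdj p q w′ → Adj v p q ⊎ CycAdj p q w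

-- Both blocks start with h and end with l, so the adjacencies across their ends are the same.
CycAdj-Replace⁻ : ∀ h l (um vm : Word) {w w′} → Replace (h ∷ um ++ [ l ]) (h ∷ vm ++ [ l ]) w w′ →
                  Inherits w′ (h ∷ vm ++ [ l ]) w
CycAdj-Replace⁻ h l um vm {w} {w′} (r , R , R′) {p} {q} c = split (Adj-++⁻ v (r ++ [ h ]) a)
  where
  u v : Word
  u = h ∷ um ++ [ l ]
  v = h ∷ vm ++ [ l ]
  a : Adj (v ++ (r ++ [ h ])) p q
  a = subst (λ Z → Adj Z p q) (++-assoc v r [ h ]) (CycAdj⇒Adj (v ++ r) (CycFactor-Rot R′ c))
  nonempty : (um ++ [ l ]) ++ r ≢ []
  nonempty = subst (_≢ []) (sym (++-assoc um [ l ] r)) (++-∷-≢-[] um l r)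
  in-w : Adj (u ++ (r ++ [ h ])) p q → CycAdj p q w
  in-w b = CycFactor-Rot (Rot-sym R)
    (Adj-closed⇒CycAdj h ((um ++ [ l ]) ++ r) nonempty (subst (λ Z → Adj Z p q) (sym (++-assoc u r [ h ])) b))
  across-end : ∀ B′ → r ++ [ h ] ≡ q ∷ B′ → l ≡ p → CycAdj p q w
  across-end B′ e refl = in-w (subst (λ Z → Adj Z l q) u-end (Adj-infix (h ∷ um)))
    where
    u-end : (h ∷ um) ++ l ∷ q ∷ B′ ≡ u ++ (r ++ [ h ])
    u-end = trans (cong (h ∷_) (sym (++-assoc um [ l ] (q ∷ B′)))) (cong (u ++_) (sym e))
  split : Adj v p q ⊎ Adj (r ++ [ h ]) p q ⊎ Straddles v (r ++ [ h ]) p q → Adj v p q ⊎ CycAdj p q w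
  split (inj₁ b) = inj₁ b
  split (inj₂ (inj₁ b)) = inj₂ (in-w (Adj-++ʳ u b))
  split (inj₂ (inj₂ ((A′ , e) , (B′ , e′)))) = inj₂ (across-end B′ e′ (proj₂ (∷ʳ-injective (h ∷ vm) A′ e)))

-- Vertices of the glued surface

∈⇒lookup : ∀ {p} {w : Word} (p∈w : p ∈ w) → lookup w (index p∈w) ≡ p
∈⇒lookup p∈w = sym (lookup-index p∈w)

lookup-injective : ∀ {w : Word} → Distinct w → ∀ i j → lookup w i ≡ lookup w j → i ≡ j
lookup-injective {z ∷ w} dist fzero fzero e = refl
lookup-injective {z ∷ w} dist fzero (fsuc j) e = ⊥-elim (Distinct-head dist (subst (_∈ w) (sym e) (∈-lookup j)))
lookup-injective {z ∷ w} dist (fsuc i) fzero e = ⊥-elim (Distinct-head dist (subst (_∈ w) e (∈-lookup i)))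
lookup-injective {z ∷ w} dist (fsuc i) (fsuc j) e = cong fsuc (lookup-injective (Distinct-tail dist) i j e)

Adj⇒positions : ∀ {w p q} → Adj w p q →
                ∃[ j ] ∃[ l ] (lookup w j ≡ p × lookup w l ≡ q × toℕ l ≡ suc (toℕ j))
Adj⇒positions hd = fzero , fsuc fzero , refl , refl , refl
Adj⇒positions (tl a) with Adj⇒positions a
... | j , l , e₁ , e₂ , e₃ = fsuc j , fsuc l , e₁ , e₂ , cong suc e₃

last-position : ∀ (X : Word) p → ∃[ j ] (lookup (X ++ [ p ]) j ≡ p × suc (toℕ j) ≡ length (X ++ [ p ]))
last-position [] p = fzero , refl , refl
last-position (z ∷ X) p with last-position X p
... | j , e , e′ = fsuc j , e , cong suc e′

CycAdj⇒IsSucMod : ∀ {w p q} → CycAdj p q w → ∃[ j ] ∃[ l ] (lookup w j ≡ p × lookup w l ≡ q × IsSucMod j l)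
CycAdj⇒IsSucMod {p = p} {q} (r , t , (P , [] , refl , refl) , refl)
  with Adj⇒positions (Adj-++ˡ [] (hd {p} {q} {t}))
... | j , l , e₁ , e₂ , e₃ = j , l , e₁ , e₂ , inj₁ e₃
CycAdj⇒IsSucMod {p = p} {q} (r , t , (P , s ∷ [] , refl , refl) , e) with ∷-injective e
... | refl , refl with last-position (q ∷ t) p
... | j , e₁ , e₂ = j , fzero , e₁ , refl , inj₂ (refl , e₂)
CycAdj⇒IsSucMod {p = p} {q} (r , t , (P , s₁ ∷ s₂ ∷ S , refl , refl) , e) with ∷-injective e
... | refl , e′ with ∷-injective e′
... | refl , _ with Adj⇒positions (Adj-infix P {p} {q} {S})
... | j , l , e₁ , e₂ , e₃ = j , l , e₁ , e₂ , inj₁ e₃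

IsSuc⇒Adj : ∀ (w : Word) j l → toℕ l ≡ suc (toℕ j) → Adj w (lookup w j) (lookup w l)
IsSuc⇒Adj (z ∷ w) j fzero ()
IsSuc⇒Adj (z ∷ []) fzero (fsuc ())
IsSuc⇒Adj (z ∷ z′ ∷ w) fzero (fsuc fzero) e = hd
IsSuc⇒Adj (z ∷ z′ ∷ w) fzero (fsuc (fsuc l)) ()
IsSuc⇒Adj (z ∷ w) (fsuc j) (fsuc l) e = tl (IsSuc⇒Adj w j l (suc-injective e))

lookup-last : ∀ (w : Word) j → suc (toℕ j) ≡ length w → ∃[ X ] w ≡ X ++ [ lookup w j ]
lookup-last (z ∷ []) fzero e = [] , refl
lookup-last (z ∷ z′ ∷ w) fzero ()
lookup-last (z ∷ w) (fsuc j) e with lookup-last w j (suc-injective e)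
... | X , e′ = z ∷ X , cong (z ∷_) e′

IsSucMod⇒CycAdj : ∀ {w : Word} → 2 ≤ length w → ∀ {j l} → IsSucMod j l → CycAdj (lookup w j) (lookup w l) w
IsSucMod⇒CycAdj {w} 2≤n {j} {l} (inj₁ e) = Adj⇒CycAdj (IsSuc⇒Adj w j l e)
IsSucMod⇒CycAdj {z ∷ w} 2≤n {j} {fsuc l} (inj₂ (() , _))
IsSucMod⇒CycAdj {z ∷ w} 2≤n {j} {fzero} (inj₂ (_ , e)) with lookup-last (z ∷ w) j e
... | [] , e′ = ⊥-elim (<-irrefl refl (≤-trans 2≤n (≤-reflexive (cong length e′))))
... | z₀ ∷ X , e′ with ∷-injective e′
... | refl , _ = _ ∷ z ∷ X , X , (z ∷ X , _ ∷ [] , e′ , refl) , refl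

-- The corner where side m starts is glued to the one where the side following m⁻¹ starts,
-- so vertices are the classes of letters under the closure of Glue.
Glue : Word → Letter → Letter → Set
Glue w m m′ = CycAdj (inv m) m′ w

Glued : Word → Letter → Letter → Set
Glued w = EqClosure (Glue w)

CycAdj⇒Glue : ∀ {w p q} → CycAdj p q w → Glue w (inv p) q
CycAdj⇒Glue = CycAdj-resp (inv-involutive _) refl

Glue⇒CycAdj : ∀ {w m m′ t} → m ≡ inv t → Glue w m m′ → CycAdj t m′ w
Glue⇒CycAdj refl = CycAdj-resp (sym (inv-involutive _)) refl

Glue⇒CycAdj⁻¹ : ∀ {w m m′ t} → m ≡ t → Glue w m m′ → CycAdj (inv t) m′ w
Glue⇒CycAdj⁻¹ refl g = g

Glue⇒∈ : ∀ {w m m′} → Glue w m m′ → m′ ∈ w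
Glue⇒∈ g = proj₂ (CycAdj⇒∈ g)

Glue⇒∈⁻¹ : ∀ {w m m′} → InvClosed w → Glue w m m′ → m ∈ w
Glue⇒∈⁻¹ {w} inv∈ g = subst (_∈ w) (inv-involutive _) (inv∈ _ (proj₁ (CycAdj⇒∈ g)))

Glue⇒Glued : ∀ {w p q} → Glue w p q → Glued w p q
Glue⇒Glued g = fwd g ◅ ε

Glue⁻¹⇒Glued : ∀ {w p q} → Glue w q p → Glued w p q
Glue⁻¹⇒Glued g = bwd g ◅ ε

Glued-sym : ∀ {w a b} → Glued w a b → Glued w b a
Glued-sym {w} = symmetric (Glue w)

≡⇒Glued : ∀ {w a b} → a ≡ b → Glued w a b
≡⇒Glued refl = ε

Glued-map : ∀ {w w′} (f : Letter → Letter) → (∀ {m m′} → Glue w m m′ → Glued w′ (f m) (f m′)) →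
            ∀ {a b} → Glued w a b → Glued w′ (f a) (f b)
Glued-map f glue ε = ε
Glued-map f glue (fwd g ◅ gs) = glue g ◅◅ Glued-map f glue gs
Glued-map f glue (bwd g ◅ gs) = Glued-sym (glue g) ◅◅ Glued-map f glue gs

CornerGlue⇒Glue : ∀ {w : Word} → 2 ≤ length w → ∀ {k l} → CornerGlue w k l → Glue w (lookup w k) (lookup w l)
CornerGlue⇒Glue {w} 2≤n {k} {l} (j , e , sm) =
  CycAdj-resp (inv-moveˡ e) refl (IsSucMod⇒CycAdj 2≤n sm)

Glue⇒CornerGlue : ∀ {w : Word} → Distinct w → ∀ {k l} → Glue w (lookup w k) (lookup w l) → CornerGlue w k l
Glue⇒CornerGlue {w} dist {k} {l} g with CycAdj⇒IsSucMod g
... | j , l′ , e₁ , e₂ , sm with lookup-injective dist l′ l e₂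
... | refl = j , sym (inv-moveˡ e₁) , sm

SameVertex⇒Glued : ∀ {w : Word} → 2 ≤ length w → ∀ {i j} → SameVertex w i j → Glued w (lookup w i) (lookup w j)
SameVertex⇒Glued 2≤n ε = ε
SameVertex⇒Glued 2≤n (fwd g ◅ gs) = fwd (CornerGlue⇒Glue 2≤n g) ◅ SameVertex⇒Glued 2≤n gs
SameVertex⇒Glued 2≤n (bwd g ◅ gs) = bwd (CornerGlue⇒Glue 2≤n g) ◅ SameVertex⇒Glued 2≤n gs

Glued⇒SameVertex : ∀ {w : Word} → Distinct w → InvClosed w → ∀ {m m′} → Glued w m m′ →
                   ∀ i j → lookup w i ≡ m → lookup w j ≡ m′ → SameVertex w i j
Glued⇒SameVertex dist inv∈ ε i j refl e with lookup-injective dist i j (sym e)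
... | refl = ε
Glued⇒SameVertex {w} dist inv∈ (fwd g ◅ gs) i j refl e =
  fwd (Glue⇒CornerGlue dist (subst (Glue w (lookup w i)) (sym (∈⇒lookup (Glue⇒∈ g))) g))
  ◅ Glued⇒SameVertex dist inv∈ gs (index (Glue⇒∈ g)) j (∈⇒lookup (Glue⇒∈ g)) e
Glued⇒SameVertex {w} dist inv∈ (bwd g ◅ gs) i j refl e =
  bwd (Glue⇒CornerGlue dist (subst (λ z → Glue w z (lookup w i)) (sym (∈⇒lookup (Glue⇒∈⁻¹ inv∈ g))) g))
  ◅ Glued⇒SameVertex dist inv∈ gs (index (Glue⇒∈⁻¹ inv∈ g)) j (∈⇒lookup (Glue⇒∈⁻¹ inv∈ g)) e

record VertexMatching (w w′ : Word) : Set where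
  field
    dist : Distinct w
    inv∈ : InvClosed w
    dist′ : Distinct w′
    inv∈′ : InvClosed w′
    2≤n : 2 ≤ length w
    2≤n′ : 2 ≤ length w′
    h k : Letter → Letter
    h-∈ : ∀ m → m ∈ w′ → h m ∈ w
    k-∈ : ∀ m → m ∈ w → k m ∈ w′
    h-glue : ∀ {m m′} → Glue w′ m m′ → Glued w (h m) (h m′)
    k-glue : ∀ {m m′} → Glue w m m′ → Glued w′ (k m) (k m′)
    h∘k : ∀ m → m ∈ w → Glued w m (h (k m))
    k∘h : ∀ m → m ∈ w′ → Glued w′ m (k (h m))

HasVertices-transport : ∀ {w w′} → VertexMatching w w′ → ∀ {V} → HasVertices w V → HasVertices w′ V
HasVertices-transport {w} {w′} M {V} (cls , surj , cls⇒same , same⇒cls) = cls′ , surj′ , cls⇒same′ , same⇒cls′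
  where
  open VertexMatching M
  corner : Fin (length w′) → Fin (length w)
  corner i = index (h-∈ (lookup w′ i) (∈-lookup i))
  corner-lookup : ∀ i → lookup w (corner i) ≡ h (lookup w′ i)
  corner-lookup i = ∈⇒lookup (h-∈ (lookup w′ i) (∈-lookup i))
  cls′ : Fin (length w′) → Fin V
  cls′ i = cls (corner i)
  surj′ : ∀ v → ∃[ i ] cls′ i ≡ v
  surj′ v with surj v
  ... | c , e = i , trans (sym (same⇒cls c (corner i) same)) e
    where
    kc∈ : k (lookup w c) ∈ w′
    kc∈ = k-∈ (lookup w c) (∈-lookup c)
    i : Fin (length w′)
    i = index kc∈
    same : SameVertex w c (corner i)
    same = Glued⇒SameVertex dist inv∈ (h∘k (lookup w c) (∈-lookup c)) c (corner i) refl
             (trans (corner-lookup i) (cong h (∈⇒lookup kc∈)))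
  cls⇒same′ : ∀ i j → cls′ i ≡ cls′ j → SameVertex w′ i j
  cls⇒same′ i j e = Glued⇒SameVertex dist′ inv∈′ glued i j refl refl
    where
    glued-h : Glued w (h (lookup w′ i)) (h (lookup w′ j))
    glued-h = subst₂ (Glued w) (corner-lookup i) (corner-lookup j)
                (SameVertex⇒Glued 2≤n (cls⇒same (corner i) (corner j) e))
    glued : Glued w′ (lookup w′ i) (lookup w′ j)
    glued = k∘h _ (∈-lookup i) ◅◅ Glued-map k k-glue glued-h ◅◅ Glued-sym (k∘h _ (∈-lookup j))
  same⇒cls′ : ∀ i j → SameVertex w′ i j → cls′ i ≡ cls′ j
  same⇒cls′ i j s = same⇒cls (corner i) (corner j)
    (Glued⇒SameVertex dist inv∈ (Glued-map h h-glue (SameVertex⇒Glued 2≤n′ s)) (corner i) (corner j)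
      (corner-lookup i) (corner-lookup j))

MaxWicks-transport : ∀ g {w w′} → MaxWicks g w → IsWicks w′ → VertexMatching w w′ → length w′ ≡ length w →
                     MaxWicks g w′
MaxWicks-transport g (_ , (V , HV , euler) , n≡) W′ M n′≡n =
  W′ , (V , HasVertices-transport M HV , trans euler (cong (_+ 2) (sym n′≡n))) , trans n′≡n n≡

-- Wicks forms

Wicks⇒Distinct : ∀ {w} → IsWicks w → Distinct w
Wicks⇒Distinct {w} W l l∈w = subst (λ z → occ z w ≡ 1) (inv-involutive l)
  (IsWicks.inverse-once W (inv l) (occ-suc⇒∈ (IsWicks.inverse-once W l l∈w)))

Wicks⇒InvClosed : ∀ {w} → IsWicks w → InvClosed w
Wicks⇒InvClosed W l l∈w = occ-suc⇒∈ (IsWicks.inverse-once W l l∈w)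

Wicks⇒2≤length : ∀ {w} → IsWicks w → ∀ {x} → x ∈ w → 2 ≤ length w
Wicks⇒2≤length {w} W {x} x∈w = two-letters x∈w (Wicks⇒InvClosed W x x∈w)
  where
  two-letters : ∀ {w : Word} → x ∈ w → inv x ∈ w → 2 ≤ length w
  two-letters {z ∷ []} (here refl) (here e) = ⊥-elim (≢-inv x (sym e))
  two-letters {z ∷ z′ ∷ w} _ _ = s≤s (s≤s z≤n)

module WicksSetting (g : ℕ) {w y} (MW : MaxWicks g w) (fresh : Fresh y w) where

  W : IsWicks w
  W = proj₁ MW

  dist : Distinct w
  dist = Wicks⇒Distinct W

  inv∈ : InvClosed w
  inv∈ = Wicks⇒InvClosed W

  no-cancel : ∀ l → ¬ CycAdj l (inv l) w
  no-cancel = IsWicks.no-cancel W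

  y≢ : ∀ {l} → l ∈ w → y ≢ l
  y≢ l∈w = ∈∧∉⇒≢ l∈w (proj₁ fresh) ∘ sym

  y⁻¹≢ : ∀ {l} → l ∈ w → inv y ≢ l
  y⁻¹≢ l∈w = ∈∧∉⇒≢ l∈w (proj₂ fresh) ∘ sym

module LetterExchange (w w′ : Word) (x y : Letter) (dist : Distinct w) (inv∈ : InvClosed w)
  (x∈w : x ∈ w) (fresh : Fresh y w)
  (exchange : ∀ l → occ l w′ + (δ l x + δ l (inv x)) ≡ occ l w + (δ l y + δ l (inv y))) where

  private
    y∉w : y ∉ w
    y∉w = proj₁ fresh

    y⁻¹∉w : inv y ∉ w
    y⁻¹∉w = proj₂ fresh

    x⁻¹∈w : inv x ∈ w
    x⁻¹∈w = inv∈ x x∈w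

  occ-other : ∀ l → l ≢ x → l ≢ inv x → l ≢ y → l ≢ inv y → occ l w′ ≡ occ l w
  occ-other l l≢x l≢x⁻¹ l≢y l≢y⁻¹ with exchange l
  ... | e rewrite δ-≢ {l} {x} (l≢x ∘ sym) | δ-≢ {l} {inv x} (l≢x⁻¹ ∘ sym)
                | δ-≢ {l} {y} (l≢y ∘ sym) | δ-≢ {l} {inv y} (l≢y⁻¹ ∘ sym) =
    trans (sym (+-identityʳ _)) (trans e (+-identityʳ _))

  occ-x : occ x w′ ≡ 0
  occ-x with exchange x
  ... | e rewrite δ-refl x | δ-≢ {x} {inv x} (≢-inv x ∘ sym)
                | δ-≢ {x} {y} (∈∧∉⇒≢ x∈w y∉w ∘ sym) | δ-≢ {x} {inv y} (∈∧∉⇒≢ x∈w y⁻¹∉w ∘ sym)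
                | dist x x∈w = +-cancelʳ-≡ 1 _ 0 e

  occ-x⁻¹ : occ (inv x) w′ ≡ 0
  occ-x⁻¹ with exchange (inv x)
  ... | e rewrite δ-refl (inv x) | δ-≢ {inv x} {x} (≢-inv x)
                | δ-≢ {inv x} {y} (∈∧∉⇒≢ x⁻¹∈w y∉w ∘ sym) | δ-≢ {inv x} {inv y} (∈∧∉⇒≢ x⁻¹∈w y⁻¹∉w ∘ sym)
                | dist (inv x) x⁻¹∈w = +-cancelʳ-≡ 1 _ 0 e

  occ-y : occ y w′ ≡ 1
  occ-y with exchange y
  ... | e rewrite δ-refl y | δ-≢ {y} {x} (∈∧∉⇒≢ x∈w y∉w) | δ-≢ {y} {inv x} (∈∧∉⇒≢ x⁻¹∈w y∉w)
                | δ-≢ {y} {inv y} (≢-inv y ∘ sym) | ∉⇒occ≡0 y∉w = trans (sym (+-identityʳ _)) e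

  occ-y⁻¹ : occ (inv y) w′ ≡ 1
  occ-y⁻¹ with exchange (inv y)
  ... | e rewrite δ-refl (inv y) | δ-≢ {inv y} {x} (∈∧∉⇒≢ x∈w y⁻¹∉w) | δ-≢ {inv y} {inv x} (∈∧∉⇒≢ x⁻¹∈w y⁻¹∉w)
                | δ-≢ {inv y} {y} (≢-inv y) | ∉⇒occ≡0 y⁻¹∉w = trans (sym (+-identityʳ _)) e

  x∉w′ : x ∉ w′
  x∉w′ = occ≡0⇒∉ occ-x

  x⁻¹∉w′ : inv x ∉ w′
  x⁻¹∉w′ = occ≡0⇒∉ occ-x⁻¹

  y∈w′ : y ∈ w′
  y∈w′ = occ-suc⇒∈ occ-y

  y⁻¹∈w′ : inv y ∈ w′
  y⁻¹∈w′ = occ-suc⇒∈ occ-y⁻¹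

  ∈w⇒∈w′ : ∀ {l} → l ∈ w → l ≢ x → l ≢ inv x → l ∈ w′
  ∈w⇒∈w′ {l} l∈w l≢x l≢x⁻¹ with ∈⇒occ-suc l∈w
  ... | k , e = occ-suc⇒∈ (trans (occ-other l l≢x l≢x⁻¹ (∈∧∉⇒≢ l∈w y∉w) (∈∧∉⇒≢ l∈w y⁻¹∉w)) e)

  ∈w′⇒∈w : ∀ {l} → l ∈ w′ → l ≢ y → l ≢ inv y → l ∈ w
  ∈w′⇒∈w {l} l∈w′ l≢y l≢y⁻¹ with ∈⇒occ-suc l∈w′
  ... | k , e = occ-suc⇒∈ (trans (sym (occ-other l (∈∧∉⇒≢ l∈w′ x∉w′) (∈∧∉⇒≢ l∈w′ x⁻¹∉w′) l≢y l≢y⁻¹)) e)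

  dist′ : Distinct w′
  dist′ l l∈w′ with l ≟L y | l ≟L inv y
  ... | yes refl | _ = occ-y
  ... | no _ | yes refl = occ-y⁻¹
  ... | no l≢y | no l≢y⁻¹ =
    trans (occ-other l (∈∧∉⇒≢ l∈w′ x∉w′) (∈∧∉⇒≢ l∈w′ x⁻¹∉w′) l≢y l≢y⁻¹) (dist l (∈w′⇒∈w l∈w′ l≢y l≢y⁻¹))

  inv∈′ : InvClosed w′
  inv∈′ l l∈w′ with l ≟L y | l ≟L inv y
  ... | yes refl | _ = y⁻¹∈w′
  ... | no _ | yes refl = subst (_∈ w′) (sym (inv-involutive y)) y∈w′
  ... | no l≢y | no l≢y⁻¹ =
    ∈w⇒∈w′ (inv∈ l (∈w′⇒∈w l∈w′ l≢y l≢y⁻¹))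
      (λ e → ∈∧∉⇒≢ l∈w′ x⁻¹∉w′ (inv-moveʳ e)) (λ e → ∈∧∉⇒≢ l∈w′ x∉w′ (inv-injective e))

  inverse-once′ : ∀ l → l ∈ w′ → occ (inv l) w′ ≡ 1
  inverse-once′ l l∈w′ = dist′ (inv l) (inv∈′ l l∈w′)

-- Type 1 transformations

data Position (S T : List Letter) (m : Letter) : Set where
  in₁ : m ∈ S → Position S T m
  in₂ : m ∉ S → m ∈ T → Position S T m
  out : m ∉ S → m ∉ T → Position S T m

position : ∀ S T m → Position S T m
position S T m with m ∈? S | m ∈? T
... | yes m∈S | _ = in₁ m∈S
... | no m∉S | yes m∈T = in₂ m∉S m∈T
... | no m∉S | no m∉T = out m∉S m∉T

-- Opaque, so that a with on position does not also abstract the goals mentioning collapse.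
opaque
  collapse : Letter → List Letter → List Letter → Letter → Letter → Letter
  collapse m S T s t with position S T m
  ... | in₁ _ = s
  ... | in₂ _ _ = t
  ... | out _ _ = m

  collapse-∈₁ : ∀ {m S T s t} → m ∈ S → collapse m S T s t ≡ s
  collapse-∈₁ {m} {S} {T} m∈S with position S T m
  ... | in₁ _ = refl
  ... | in₂ m∉S _ = ⊥-elim (m∉S m∈S)
  ... | out m∉S _ = ⊥-elim (m∉S m∈S)

  collapse-∈₂ : ∀ {m S T s t} → m ∉ S → m ∈ T → collapse m S T s t ≡ t
  collapse-∈₂ {m} {S} {T} m∉S m∈T with position S T m
  ... | in₁ m∈S = ⊥-elim (m∉S m∈S)
  ... | in₂ _ _ = refl
  ... | out _ m∉T = ⊥-elim (m∉T m∈T)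

  collapse-∉ : ∀ {m S T s t} → m ∉ S → m ∉ T → collapse m S T s t ≡ m
  collapse-∉ {m} {S} {T} m∉S m∉T with position S T m
  ... | in₁ m∈S = ⊥-elim (m∉S m∈S)
  ... | in₂ _ m∈T = ⊥-elim (m∉T m∈T)
  ... | out _ _ = refl

∈-triple⁻ : ∀ {m p₁ p₂ p₃ : Letter} → m ∈ p₁ ∷ p₂ ∷ p₃ ∷ [] → m ≡ p₁ ⊎ m ≡ p₂ ⊎ m ≡ p₃
∈-triple⁻ (here e) = inj₁ e
∈-triple⁻ (there (here e)) = inj₂ (inj₁ e)
∈-triple⁻ (there (there (here e))) = inj₂ (inj₂ e)

∉-triple : ∀ {m p₁ p₂ p₃ : Letter} → m ≢ p₁ → m ≢ p₂ → m ≢ p₃ → m ∉ p₁ ∷ p₂ ∷ p₃ ∷ []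
∉-triple m≢p₁ m≢p₂ m≢p₃ m∈ with ∈-triple⁻ m∈
... | inj₁ e = m≢p₁ e
... | inj₂ (inj₁ e) = m≢p₂ e
... | inj₂ (inj₂ e) = m≢p₃ e

∈₁ : ∀ {m p₁ p₂ p₃ : Letter} → m ≡ p₁ → m ∈ p₁ ∷ p₂ ∷ p₃ ∷ []
∈₁ e = here e

∈₂ : ∀ {m p₁ p₂ p₃ : Letter} → m ≡ p₂ → m ∈ p₁ ∷ p₂ ∷ p₃ ∷ []
∈₂ e = there (here e)

∈₃ : ∀ {m p₁ p₂ p₃ : Letter} → m ≡ p₃ → m ∈ p₁ ∷ p₂ ∷ p₃ ∷ []
∈₃ e = there (there (here e))

∉-⊎ : ∀ {A : Set} {m : Letter} {S T : List Letter} → m ∉ S → m ∉ T → m ∈ S ⊎ m ∈ T → A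
∉-⊎ m∉S m∉T (inj₁ m∈S) = ⊥-elim (m∉S m∈S)
∉-⊎ m∉S m∉T (inj₂ m∈T) = ⊥-elim (m∉T m∈T)

module Type1 (g : ℕ) (w w′ : Word) (x y : Letter) (MW : MaxWicks g w) (x∈w : x ∈ w) (fresh : Fresh y w)
  (a b c d : Letter) (w₁ w₂ w₃ : Word)
  (axb : CycFactor (a ∷ x ∷ b ∷ []) w) (cx⁻¹d : CycFactor (c ∷ inv x ∷ d ∷ []) w)
  (R₁ : Replace (a ∷ x ∷ b ∷ []) (a ∷ b ∷ []) w w₁)
  (R₂ : Replace (c ∷ inv x ∷ d ∷ []) (c ∷ d ∷ []) w₁ w₂)
  (R₃ : Replace (inv d ∷ inv a ∷ []) (inv d ∷ y ∷ inv a ∷ []) w₂ w₃)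
  (R₄ : Replace (inv b ∷ inv c ∷ []) (inv b ∷ inv y ∷ inv c ∷ []) w₃ w′) where

  open WicksSetting g MW fresh

  a·x : CycAdj a x w
  a·x = CycFactor⇒CycAdj axb
  x·b : CycAdj x b w
  x·b = CycFactor⇒CycAdj (CycFactor-tail axb)
  c·x⁻¹ : CycAdj c (inv x) w
  c·x⁻¹ = CycFactor⇒CycAdj cx⁻¹d
  x⁻¹·d : CycAdj (inv x) d w
  x⁻¹·d = CycFactor⇒CycAdj (CycFactor-tail cx⁻¹d)

  a∈w : a ∈ w
  a∈w = proj₁ (CycAdj⇒∈ a·x)
  b∈w : b ∈ w
  b∈w = proj₂ (CycAdj⇒∈ x·b)
  c∈w : c ∈ w
  c∈w = proj₁ (CycAdj⇒∈ c·x⁻¹)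
  d∈w : d ∈ w
  d∈w = proj₂ (CycAdj⇒∈ x⁻¹·d)
  a⁻¹∈w : inv a ∈ w
  a⁻¹∈w = inv∈ a a∈w
  b⁻¹∈w : inv b ∈ w
  b⁻¹∈w = inv∈ b b∈w
  c⁻¹∈w : inv c ∈ w
  c⁻¹∈w = inv∈ c c∈w

  back₁ : Inherits w₁ (a ∷ b ∷ []) w
  back₁ = CycAdj-Replace⁻ a b [ x ] [] R₁
  back₂ : Inherits w₂ (c ∷ d ∷ []) w₁
  back₂ = CycAdj-Replace⁻ c d [ inv x ] [] R₂
  back₃ : Inherits w₃ (inv d ∷ y ∷ inv a ∷ []) w₂
  back₃ = CycAdj-Replace⁻ (inv d) (inv a) [] [ y ] R₃
  back₄ : Inherits w′ (inv b ∷ inv y ∷ inv c ∷ []) w₃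
  back₄ = CycAdj-Replace⁻ (inv b) (inv c) [] [ inv y ] R₄
  forth₁ : Inherits w (a ∷ x ∷ b ∷ []) w₁
  forth₁ = CycAdj-Replace⁻ a b [] [ x ] (Replace-sym R₁)
  forth₂ : Inherits w₁ (c ∷ inv x ∷ d ∷ []) w₂
  forth₂ = CycAdj-Replace⁻ c d [] [ inv x ] (Replace-sym R₂)
  forth₃ : Inherits w₂ (inv d ∷ inv a ∷ []) w₃
  forth₃ = CycAdj-Replace⁻ (inv d) (inv a) [ y ] [] (Replace-sym R₃)
  forth₄ : Inherits w₃ (inv b ∷ inv c ∷ []) w′
  forth₄ = CycAdj-Replace⁻ (inv b) (inv c) [ inv y ] [] (Replace-sym R₄)

  a≢c : a ≢ c
  a≢c refl = ≢-inv x (CycAdj-functional dist a·x c·x⁻¹)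
  b≢d : b ≢ d
  b≢d refl = ≢-inv x (CycAdj-injective dist x·b x⁻¹·d)
  x≢b : x ≢ b
  x≢b refl = ¬CycAdj-self dist x·b
  x⁻¹≢d : inv x ≢ d
  x⁻¹≢d refl = ¬CycAdj-self dist x⁻¹·d
  a≢x : a ≢ x
  a≢x refl = ¬CycAdj-self dist a·x
  c≢x⁻¹ : c ≢ inv x
  c≢x⁻¹ refl = ¬CycAdj-self dist c·x⁻¹
  a≢x⁻¹ : a ≢ inv x
  a≢x⁻¹ refl = no-cancel (inv x) (CycAdj-resp refl (inv-involutive x) a·x)

  -- The blocks d⁻¹a⁻¹ and b⁻¹c⁻¹ rewritten by R₃ and R₄ are not among the adjacencies created by
  -- R₁ and R₂, so they already occur in w.
  d⁻¹·a⁻¹ : CycAdj (inv d) (inv a) w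
  d⁻¹·a⁻¹ with back₂ (CycAdj-Replace⁺ (Replace-sym R₃) hd)
  ... | inj₁ a′ with Adj-pair a′
  ...   | e₁ , e₂ = ⊥-elim (a≢c (sym (trans (sym e₁) (trans (cong inv (sym e₂)) (inv-involutive a)))))
  d⁻¹·a⁻¹ | inj₂ c₁ with back₁ c₁
  ... | inj₁ a′ with Adj-pair a′
  ...   | e₁ , e₂ = ⊥-elim (b≢d (trans (sym e₂) (sym (inv-moveʳ e₁))))
  d⁻¹·a⁻¹ | inj₂ c₁ | inj₂ c₀ = c₀

  b⁻¹·c⁻¹ : CycAdj (inv b) (inv c) w
  b⁻¹·c⁻¹ with back₃ (CycAdj-Replace⁺ (Replace-sym R₄) hd)
  ... | inj₁ a′ with Adj-triple a′
  ...   | inj₁ (_ , e₂) = ⊥-elim (y≢ c⁻¹∈w (sym e₂))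
  ...   | inj₂ (e₁ , _) = ⊥-elim (y≢ b⁻¹∈w (sym e₁))
  b⁻¹·c⁻¹ | inj₂ c₂ with back₂ c₂
  ... | inj₁ a′ with Adj-pair a′
  ...   | e₁ , e₂ = ⊥-elim (b≢d (sym (trans (sym e₂) (trans (cong inv (sym e₁)) (inv-involutive b)))))
  b⁻¹·c⁻¹ | inj₂ c₂ | inj₂ c₁ with back₁ c₁
  ... | inj₁ a′ with Adj-pair a′
  ...   | e₁ , e₂ = ⊥-elim (a≢c (sym (trans (inv-moveʳ e₂) e₁)))
  b⁻¹·c⁻¹ | inj₂ c₂ | inj₂ c₁ | inj₂ c₀ = c₀

  d≢c⁻¹ : d ≢ inv c
  d≢c⁻¹ refl = x≢b (inv-injective (CycAdj-injective dist x⁻¹·d b⁻¹·c⁻¹))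
  b≢a⁻¹ : b ≢ inv a
  b≢a⁻¹ refl = x⁻¹≢d (inv-moveˡ (CycAdj-injective dist x·b d⁻¹·a⁻¹))
  c⁻¹≢b : inv c ≢ b
  c⁻¹≢b e = no-cancel (inv b) (CycAdj-resp refl (trans (inv-involutive b) (sym e)) b⁻¹·c⁻¹)
  d≢a⁻¹ : d ≢ inv a
  d≢a⁻¹ e = no-cancel a (CycAdj-resp (sym (inv-moveˡ e)) refl d⁻¹·a⁻¹)

  a·b′ : CycAdj a b w′
  a·b′ with forth₂ (CycAdj-Replace⁺ R₁ hd)
  ... | inj₁ a′ with Adj-triple a′
  ...   | inj₁ (e₁ , _) = ⊥-elim (a≢c e₁)
  ...   | inj₂ (e₁ , _) = ⊥-elim (a≢x⁻¹ e₁)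
  a·b′ | inj₂ c₂ with forth₃ c₂
  ... | inj₁ a′ = ⊥-elim (b≢a⁻¹ (proj₂ (Adj-pair a′)))
  ... | inj₂ c₃ with forth₄ c₃
  ...   | inj₁ a′ = ⊥-elim (b≢a⁻¹ (sym (inv-moveˡ (proj₁ (Adj-pair a′)))))
  ...   | inj₂ c₄ = c₄

  c·d′ : CycAdj c d w′
  c·d′ with forth₃ (CycAdj-Replace⁺ R₂ hd)
  ... | inj₁ a′ = ⊥-elim (d≢a⁻¹ (proj₂ (Adj-pair a′)))
  ... | inj₂ c₃ with forth₄ c₃
  ...   | inj₁ a′ = ⊥-elim (d≢c⁻¹ (proj₂ (Adj-pair a′)))
  ...   | inj₂ c₄ = c₄

  d⁻¹·y′ : CycAdj (inv d) y w′
  d⁻¹·y′ with forth₄ (CycAdj-Replace⁺ R₃ hd)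
  ... | inj₁ a′ = ⊥-elim (y≢ c⁻¹∈w (proj₂ (Adj-pair a′)))
  ... | inj₂ c₄ = c₄

  y·a⁻¹′ : CycAdj y (inv a) w′
  y·a⁻¹′ with forth₄ (CycAdj-Replace⁺ R₃ (tl hd))
  ... | inj₁ a′ = ⊥-elim (y≢ b⁻¹∈w (proj₁ (Adj-pair a′)))
  ... | inj₂ c₄ = c₄

  b⁻¹·y⁻¹′ : CycAdj (inv b) (inv y) w′
  b⁻¹·y⁻¹′ = CycAdj-Replace⁺ R₄ hd

  y⁻¹·c⁻¹′ : CycAdj (inv y) (inv c) w′
  y⁻¹·c⁻¹′ = CycAdj-Replace⁺ R₄ (tl hd)

  removed inserted : Word
  removed = a ∷ x ∷ b ∷ c ∷ inv x ∷ d ∷ inv d ∷ inv a ∷ inv b ∷ inv c ∷ []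
  inserted = a ∷ b ∷ c ∷ d ∷ inv d ∷ y ∷ inv a ∷ inv b ∷ inv y ∷ inv c ∷ []

  occ-replaced : ∀ l → occ l w + occ l inserted ≡ occ l w′ + occ l removed
  occ-replaced l = Occ.μ-Replace₄ l R₁ R₂ R₃ R₄

  occ-exchange : ∀ l → occ l w′ + (δ l x + δ l (inv x)) ≡ occ l w + (δ l y + δ l (inv y))
  occ-exchange = occ-trade w w′ x y removed inserted occ-replaced λ l →
    solve 12 (λ A B C D A⁻ B⁻ C⁻ D⁻ X X⁻ Y Y⁻ →
       (A :+ (B :+ (C :+ (D :+ (D⁻ :+ (Y :+ (A⁻ :+ (B⁻ :+ (Y⁻ :+ (C⁻ :+ con 0)))))))))) :+ (X :+ X⁻)
       := (A :+ (X :+ (B :+ (C :+ (X⁻ :+ (D :+ (D⁻ :+ (A⁻ :+ (B⁻ :+ (C⁻ :+ con 0)))))))))) :+ (Y :+ Y⁻))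
       refl (δ l a) (δ l b) (δ l c) (δ l d) (δ l (inv a)) (δ l (inv b)) (δ l (inv c)) (δ l (inv d))
            (δ l x) (δ l (inv x)) (δ l y) (δ l (inv y))

  length-w′ : length w′ ≡ length w
  length-w′ = sym (+-cancelʳ-≡ 10 (length w) (length w′)
    (Length.μ-Replace₄ R₁ R₂ R₃ R₄))

  open LetterExchange w w′ x y dist inv∈ x∈w fresh occ-exchange public

  data NewPair : Letter → Letter → Set where
    ab : NewPair a b
    cd : NewPair c d
    d⁻¹y : NewPair (inv d) y
    ya⁻¹ : NewPair y (inv a)
    b⁻¹y⁻¹ : NewPair (inv b) (inv y)
    y⁻¹c⁻¹ : NewPair (inv y) (inv c)

  data OldPair : Letter → Letter → Set where
    ax : OldPair a x
    xb : OldPair x b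
    cx⁻¹ : OldPair c (inv x)
    x⁻¹d : OldPair (inv x) d
    d⁻¹a⁻¹ : OldPair (inv d) (inv a)
    b⁻¹c⁻¹ : OldPair (inv b) (inv c)

  subst-pair : ∀ {R : Letter → Letter → Set} {p q p′ q′} → R p′ q′ → p ≡ p′ × q ≡ q′ → R p q
  subst-pair r (refl , refl) = r

  CycAdj-w′⇒w : ∀ {p q} → CycAdj p q w′ → NewPair p q ⊎ CycAdj p q w
  CycAdj-w′⇒w c with back₄ c
  ... | inj₁ a′ with Adj-triple a′
  ...   | inj₁ e = inj₁ (subst-pair b⁻¹y⁻¹ e)
  ...   | inj₂ e = inj₁ (subst-pair y⁻¹c⁻¹ e)
  CycAdj-w′⇒w c | inj₂ c₃ with back₃ c₃
  ... | inj₁ a′ with Adj-triple a′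
  ...   | inj₁ e = inj₁ (subst-pair d⁻¹y e)
  ...   | inj₂ e = inj₁ (subst-pair ya⁻¹ e)
  CycAdj-w′⇒w c | inj₂ c₃ | inj₂ c₂ with back₂ c₂
  ... | inj₁ a′ = inj₁ (subst-pair cd (Adj-pair a′))
  ... | inj₂ c₁ with back₁ c₁
  ...   | inj₁ a′ = inj₁ (subst-pair ab (Adj-pair a′))
  ...   | inj₂ c₀ = inj₂ c₀

  CycAdj-w⇒w′ : ∀ {p q} → CycAdj p q w → OldPair p q ⊎ CycAdj p q w′
  CycAdj-w⇒w′ c with forth₁ c
  ... | inj₁ a′ with Adj-triple a′
  ...   | inj₁ e = inj₁ (subst-pair ax e)
  ...   | inj₂ e = inj₁ (subst-pair xb e)
  CycAdj-w⇒w′ c | inj₂ c₁ with forth₂ c₁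
  ... | inj₁ a′ with Adj-triple a′
  ...   | inj₁ e = inj₁ (subst-pair cx⁻¹ e)
  ...   | inj₂ e = inj₁ (subst-pair x⁻¹d e)
  CycAdj-w⇒w′ c | inj₂ c₁ | inj₂ c₂ with forth₃ c₂
  ... | inj₁ a′ = inj₁ (subst-pair d⁻¹a⁻¹ (Adj-pair a′))
  ... | inj₂ c₃ with forth₄ c₃
  ...   | inj₁ a′ = inj₁ (subst-pair b⁻¹c⁻¹ (Adj-pair a′))
  ...   | inj₂ c₄ = inj₂ c₄

  -- The corners at x, d, a⁻¹ and at b, c⁻¹, x⁻¹ form two vertices of w, those at b, y⁻¹, a⁻¹ and at
  -- d, y, c⁻¹ two vertices of w′, and all other gluings agree; h and k send these classes to a⁻¹, c⁻¹.
  P Q P′ Q′ : List Letter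
  P = x ∷ d ∷ inv a ∷ []
  Q = b ∷ inv c ∷ inv x ∷ []
  P′ = b ∷ inv y ∷ inv a ∷ []
  Q′ = d ∷ y ∷ inv c ∷ []

  h k : Letter → Letter
  h m = collapse m P′ Q′ (inv a) (inv c)
  k m = collapse m P Q (inv a) (inv c)

  c⁻¹∉P′ : inv c ∉ P′
  c⁻¹∉P′ = ∉-triple c⁻¹≢b (y⁻¹≢ c⁻¹∈w ∘ sym) (a≢c ∘ sym ∘ inv-injective)
  y∉P′ : y ∉ P′
  y∉P′ = ∉-triple (y≢ b∈w) (≢-inv y) (y≢ a⁻¹∈w)
  d∉P′ : d ∉ P′
  d∉P′ = ∉-triple (b≢d ∘ sym) (y⁻¹≢ d∈w ∘ sym) d≢a⁻¹
  c⁻¹∉P : inv c ∉ P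
  c⁻¹∉P = ∉-triple (c≢x⁻¹ ∘ inv-moveʳ) (d≢c⁻¹ ∘ sym) (a≢c ∘ sym ∘ inv-injective)
  x⁻¹∉P : inv x ∉ P
  x⁻¹∉P = ∉-triple (≢-inv x ∘ sym) x⁻¹≢d (a≢x ∘ sym ∘ inv-injective)
  b∉P : b ∉ P
  b∉P = ∉-triple (x≢b ∘ sym) b≢d b≢a⁻¹

  Q′⇒∉P′ : ∀ {z} → z ∈ Q′ → z ∉ P′
  Q′⇒∉P′ z∈Q′ with ∈-triple⁻ z∈Q′
  ... | inj₁ refl = d∉P′
  ... | inj₂ (inj₁ refl) = y∉P′
  ... | inj₂ (inj₂ refl) = c⁻¹∉P′

  Q⇒∉P : ∀ {z} → z ∈ Q → z ∉ P
  Q⇒∉P z∈Q with ∈-triple⁻ z∈Q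
  ... | inj₁ refl = b∉P
  ... | inj₂ (inj₁ refl) = c⁻¹∉P
  ... | inj₂ (inj₂ refl) = x⁻¹∉P

  P′-closed : ∀ {m m′} → m ∈ P′ → Glue w′ m m′ → m′ ∈ P′
  P′-closed m∈ g with ∈-triple⁻ m∈
  ... | inj₁ e = ∈₂ (sym (CycAdj-functional dist′ b⁻¹·y⁻¹′ (Glue⇒CycAdj⁻¹ e g)))
  ... | inj₂ (inj₁ e) = ∈₃ (sym (CycAdj-functional dist′ y·a⁻¹′ (Glue⇒CycAdj e g)))
  ... | inj₂ (inj₂ e) = ∈₁ (sym (CycAdj-functional dist′ a·b′ (Glue⇒CycAdj e g)))

  Q′-closed : ∀ {m m′} → m ∈ Q′ → Glue w′ m m′ → m′ ∈ Q′
  Q′-closed m∈ g with ∈-triple⁻ m∈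
  ... | inj₁ e = ∈₂ (sym (CycAdj-functional dist′ d⁻¹·y′ (Glue⇒CycAdj⁻¹ e g)))
  ... | inj₂ (inj₁ e) = ∈₃ (sym (CycAdj-functional dist′ y⁻¹·c⁻¹′ (Glue⇒CycAdj⁻¹ e g)))
  ... | inj₂ (inj₂ e) = ∈₁ (sym (CycAdj-functional dist′ c·d′ (Glue⇒CycAdj e g)))

  P-closed : ∀ {m m′} → m ∈ P → Glue w m m′ → m′ ∈ P
  P-closed m∈ g with ∈-triple⁻ m∈
  ... | inj₁ e = ∈₂ (sym (CycAdj-functional dist x⁻¹·d (Glue⇒CycAdj⁻¹ e g)))
  ... | inj₂ (inj₁ e) = ∈₃ (sym (CycAdj-functional dist d⁻¹·a⁻¹ (Glue⇒CycAdj⁻¹ e g)))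
  ... | inj₂ (inj₂ e) = ∈₁ (sym (CycAdj-functional dist a·x (Glue⇒CycAdj e g)))

  Q-closed : ∀ {m m′} → m ∈ Q → Glue w m m′ → m′ ∈ Q
  Q-closed m∈ g with ∈-triple⁻ m∈
  ... | inj₁ e = ∈₂ (sym (CycAdj-functional dist b⁻¹·c⁻¹ (Glue⇒CycAdj⁻¹ e g)))
  ... | inj₂ (inj₁ e) = ∈₃ (sym (CycAdj-functional dist c·x⁻¹ (Glue⇒CycAdj e g)))
  ... | inj₂ (inj₂ e) = ∈₁ (sym (CycAdj-functional dist x·b (Glue⇒CycAdj e g)))

  outside-closed′ : ∀ {m m′} → m ∉ P′ → m ∉ Q′ → Glue w′ m m′ → m′ ∉ P′ × m′ ∉ Q′
  outside-closed′ {m} m∉P′ m∉Q′ g = m′∉P′ , m′∉Q′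
    where
    g′ : ∀ {q} → _ ≡ q → CycAdj (inv m) q w′
    g′ e = subst (λ z → CycAdj (inv m) z w′) e g
    m′∉P′ : _ ∉ P′
    m′∉P′ m′∈ with ∈-triple⁻ m′∈
    ... | inj₁ e = m∉P′ (∈₃ (≡inv-sym (CycAdj-injective dist′ a·b′ (g′ e))))
    ... | inj₂ (inj₁ e) = m∉P′ (∈₁ (sym (inv-injective (CycAdj-injective dist′ b⁻¹·y⁻¹′ (g′ e)))))
    ... | inj₂ (inj₂ e) = m∉P′ (∈₂ (≡inv-sym (CycAdj-injective dist′ y·a⁻¹′ (g′ e))))
    m′∉Q′ : _ ∉ Q′
    m′∉Q′ m′∈ with ∈-triple⁻ m′∈
    ... | inj₁ e = m∉Q′ (∈₃ (≡inv-sym (CycAdj-injective dist′ c·d′ (g′ e))))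
    ... | inj₂ (inj₁ e) = m∉Q′ (∈₁ (sym (inv-injective (CycAdj-injective dist′ d⁻¹·y′ (g′ e)))))
    ... | inj₂ (inj₂ e) = m∉Q′ (∈₂ (sym (inv-injective (CycAdj-injective dist′ y⁻¹·c⁻¹′ (g′ e)))))

  outside-closed : ∀ {m m′} → m ∉ P → m ∉ Q → Glue w m m′ → m′ ∉ P × m′ ∉ Q
  outside-closed {m} m∉P m∉Q g = m′∉P , m′∉Q
    where
    g′ : ∀ {q} → _ ≡ q → CycAdj (inv m) q w
    g′ e = subst (λ z → CycAdj (inv m) z w) e g
    m′∉P : _ ∉ P
    m′∉P m′∈ with ∈-triple⁻ m′∈
    ... | inj₁ e = m∉P (∈₃ (≡inv-sym (CycAdj-injective dist a·x (g′ e))))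
    ... | inj₂ (inj₁ e) = m∉P (∈₁ (sym (inv-injective (CycAdj-injective dist x⁻¹·d (g′ e)))))
    ... | inj₂ (inj₂ e) = m∉P (∈₂ (sym (inv-injective (CycAdj-injective dist d⁻¹·a⁻¹ (g′ e)))))
    m′∉Q : _ ∉ Q
    m′∉Q m′∈ with ∈-triple⁻ m′∈
    ... | inj₁ e = m∉Q (∈₃ (≡inv-sym (CycAdj-injective dist x·b (g′ e))))
    ... | inj₂ (inj₁ e) = m∉Q (∈₁ (sym (inv-injective (CycAdj-injective dist b⁻¹·c⁻¹ (g′ e)))))
    ... | inj₂ (inj₂ e) = m∉Q (∈₂ (≡inv-sym (CycAdj-injective dist c·x⁻¹ (g′ e))))

  NewPair⇒P′Q′ : ∀ {p q} → NewPair p q → ∀ m → p ≡ inv m → m ∈ P′ ⊎ m ∈ Q′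
  NewPair⇒P′Q′ ab m e = inj₁ (∈₃ (≡inv-sym e))
  NewPair⇒P′Q′ cd m e = inj₂ (∈₃ (≡inv-sym e))
  NewPair⇒P′Q′ d⁻¹y m e = inj₂ (∈₁ (sym (inv-injective e)))
  NewPair⇒P′Q′ ya⁻¹ m e = inj₁ (∈₂ (≡inv-sym e))
  NewPair⇒P′Q′ b⁻¹y⁻¹ m e = inj₁ (∈₁ (sym (inv-injective e)))
  NewPair⇒P′Q′ y⁻¹c⁻¹ m e = inj₂ (∈₂ (sym (inv-injective e)))

  OldPair⇒PQ : ∀ {p q} → OldPair p q → ∀ m → p ≡ inv m → m ∈ P ⊎ m ∈ Q
  OldPair⇒PQ ax m e = inj₁ (∈₃ (≡inv-sym e))
  OldPair⇒PQ xb m e = inj₂ (∈₃ (≡inv-sym e))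
  OldPair⇒PQ cx⁻¹ m e = inj₂ (∈₂ (≡inv-sym e))
  OldPair⇒PQ x⁻¹d m e = inj₁ (∈₁ (sym (inv-injective e)))
  OldPair⇒PQ d⁻¹a⁻¹ m e = inj₁ (∈₂ (sym (inv-injective e)))
  OldPair⇒PQ b⁻¹c⁻¹ m e = inj₂ (∈₁ (sym (inv-injective e)))

  h-glue : ∀ {m m′} → Glue w′ m m′ → Glued w (h m) (h m′)
  h-glue {m} {m′} g with position P′ Q′ m
  ... | in₁ m∈P′ = ≡⇒Glued (trans (collapse-∈₁ m∈P′) (sym (collapse-∈₁ (P′-closed m∈P′ g))))
  ... | in₂ m∉P′ m∈Q′ =
    ≡⇒Glued (trans (collapse-∈₂ m∉P′ m∈Q′) (sym (collapse-∈₂ (Q′⇒∉P′ (Q′-closed m∈Q′ g)) (Q′-closed m∈Q′ g))))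
  ... | out m∉P′ m∉Q′ with CycAdj-w′⇒w g | outside-closed′ m∉P′ m∉Q′ g
  ...   | inj₁ new | _ = ∉-⊎ m∉P′ m∉Q′ (NewPair⇒P′Q′ new m refl)
  ...   | inj₂ g₀ | m′∉P′ , m′∉Q′ =
    subst₂ (Glued w) (sym (collapse-∉ m∉P′ m∉Q′)) (sym (collapse-∉ m′∉P′ m′∉Q′)) (Glue⇒Glued g₀)

  k-glue : ∀ {m m′} → Glue w m m′ → Glued w′ (k m) (k m′)
  k-glue {m} {m′} g with position P Q m
  ... | in₁ m∈P = ≡⇒Glued (trans (collapse-∈₁ m∈P) (sym (collapse-∈₁ (P-closed m∈P g))))
  ... | in₂ m∉P m∈Q =
    ≡⇒Glued (trans (collapse-∈₂ m∉P m∈Q) (sym (collapse-∈₂ (Q⇒∉P (Q-closed m∈Q g)) (Q-closed m∈Q g))))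
  ... | out m∉P m∉Q with CycAdj-w⇒w′ g | outside-closed m∉P m∉Q g
  ...   | inj₁ old | _ = ∉-⊎ m∉P m∉Q (OldPair⇒PQ old m refl)
  ...   | inj₂ g′ | m′∉P , m′∉Q =
    subst₂ (Glued w′) (sym (collapse-∉ m∉P m∉Q)) (sym (collapse-∉ m′∉P m′∉Q)) (Glue⇒Glued g′)

  h-a⁻¹ : h (inv a) ≡ inv a
  h-a⁻¹ = collapse-∈₁ (∈₃ refl)
  h-c⁻¹ : h (inv c) ≡ inv c
  h-c⁻¹ = collapse-∈₂ c⁻¹∉P′ (∈₃ refl)
  k-a⁻¹ : k (inv a) ≡ inv a
  k-a⁻¹ = collapse-∈₁ (∈₃ refl)
  k-c⁻¹ : k (inv c) ≡ inv c
  k-c⁻¹ = collapse-∈₂ c⁻¹∉P (∈₂ refl)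

  h∘k : ∀ m → m ∈ w → Glued w m (h (k m))
  h∘k m m∈w with position P Q m
  ... | in₁ m∈P = to-a⁻¹ (∈-triple⁻ m∈P) ◅◅ ≡⇒Glued (sym (trans (cong h (collapse-∈₁ m∈P)) h-a⁻¹))
    where
    to-a⁻¹ : m ≡ x ⊎ m ≡ d ⊎ m ≡ inv a → Glued w m (inv a)
    to-a⁻¹ (inj₁ refl) = Glue⁻¹⇒Glued (CycAdj⇒Glue a·x)
    to-a⁻¹ (inj₂ (inj₁ refl)) = Glue⇒Glued d⁻¹·a⁻¹
    to-a⁻¹ (inj₂ (inj₂ refl)) = ε
  ... | in₂ m∉P m∈Q = to-c⁻¹ (∈-triple⁻ m∈Q) ◅◅ ≡⇒Glued (sym (trans (cong h (collapse-∈₂ m∉P m∈Q)) h-c⁻¹))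
    where
    to-c⁻¹ : m ≡ b ⊎ m ≡ inv c ⊎ m ≡ inv x → Glued w m (inv c)
    to-c⁻¹ (inj₁ refl) = Glue⇒Glued b⁻¹·c⁻¹
    to-c⁻¹ (inj₂ (inj₁ refl)) = ε
    to-c⁻¹ (inj₂ (inj₂ refl)) = Glue⁻¹⇒Glued (CycAdj⇒Glue c·x⁻¹)
  ... | out m∉P m∉Q = ≡⇒Glued (sym (trans (cong h (collapse-∉ m∉P m∉Q)) (collapse-∉ m∉P′ m∉Q′)))
    where
    m∉P′ : m ∉ P′
    m∉P′ = ∉-triple (m∉Q ∘ ∈₁) (y⁻¹≢ m∈w ∘ sym) (m∉P ∘ ∈₃)
    m∉Q′ : m ∉ Q′
    m∉Q′ = ∉-triple (m∉P ∘ ∈₂) (y≢ m∈w ∘ sym) (m∉Q ∘ ∈₂)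

  k∘h : ∀ m → m ∈ w′ → Glued w′ m (k (h m))
  k∘h m m∈w′ with position P′ Q′ m
  ... | in₁ m∈P′ = to-a⁻¹ (∈-triple⁻ m∈P′) ◅◅ ≡⇒Glued (sym (trans (cong k (collapse-∈₁ m∈P′)) k-a⁻¹))
    where
    to-a⁻¹ : m ≡ b ⊎ m ≡ inv y ⊎ m ≡ inv a → Glued w′ m (inv a)
    to-a⁻¹ (inj₁ refl) = Glue⁻¹⇒Glued (CycAdj⇒Glue a·b′)
    to-a⁻¹ (inj₂ (inj₁ refl)) = Glue⇒Glued (CycAdj⇒Glue y·a⁻¹′)
    to-a⁻¹ (inj₂ (inj₂ refl)) = ε
  ... | in₂ m∉P′ m∈Q′ = to-c⁻¹ (∈-triple⁻ m∈Q′) ◅◅ ≡⇒Glued (sym (trans (cong k (collapse-∈₂ m∉P′ m∈Q′)) k-c⁻¹))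
    where
    to-c⁻¹ : m ≡ d ⊎ m ≡ y ⊎ m ≡ inv c → Glued w′ m (inv c)
    to-c⁻¹ (inj₁ refl) = Glue⁻¹⇒Glued (CycAdj⇒Glue c·d′)
    to-c⁻¹ (inj₂ (inj₁ refl)) = Glue⇒Glued y⁻¹·c⁻¹′
    to-c⁻¹ (inj₂ (inj₂ refl)) = ε
  ... | out m∉P′ m∉Q′ = ≡⇒Glued (sym (trans (cong k (collapse-∉ m∉P′ m∉Q′)) (collapse-∉ m∉P m∉Q)))
    where
    m∉P : m ∉ P
    m∉P = ∉-triple (λ e → x∉w′ (subst (_∈ w′) e m∈w′)) (m∉Q′ ∘ ∈₁) (m∉P′ ∘ ∈₃)
    m∉Q : m ∉ Q
    m∉Q = ∉-triple (m∉P′ ∘ ∈₁) (m∉Q′ ∘ ∈₃) (λ e → x⁻¹∉w′ (subst (_∈ w′) e m∈w′))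

  h-∈ : ∀ m → m ∈ w′ → h m ∈ w
  h-∈ m m∈w′ with position P′ Q′ m
  ... | in₁ m∈P′ = subst (_∈ w) (sym (collapse-∈₁ m∈P′)) a⁻¹∈w
  ... | in₂ m∉P′ m∈Q′ = subst (_∈ w) (sym (collapse-∈₂ m∉P′ m∈Q′)) c⁻¹∈w
  ... | out m∉P′ m∉Q′ = subst (_∈ w) (sym (collapse-∉ m∉P′ m∉Q′)) (∈w′⇒∈w m∈w′ (m∉Q′ ∘ ∈₂) (m∉P′ ∘ ∈₂))

  k-∈ : ∀ m → m ∈ w → k m ∈ w′
  k-∈ m m∈w with position P Q m
  ... | in₁ m∈P = subst (_∈ w′) (sym (collapse-∈₁ m∈P)) (proj₂ (CycAdj⇒∈ y·a⁻¹′))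
  ... | in₂ m∉P m∈Q = subst (_∈ w′) (sym (collapse-∈₂ m∉P m∈Q)) (proj₂ (CycAdj⇒∈ y⁻¹·c⁻¹′))
  ... | out m∉P m∉Q = subst (_∈ w′) (sym (collapse-∉ m∉P m∉Q)) (∈w⇒∈w′ m∈w (m∉P ∘ ∈₁) (m∉Q ∘ ∈₃))

  2≤n : 2 ≤ length w
  2≤n = Wicks⇒2≤length W x∈w

  matching : VertexMatching w w′
  matching = record
    { dist = dist ; inv∈ = inv∈ ; dist′ = dist′ ; inv∈′ = inv∈′
    ; 2≤n = 2≤n ; 2≤n′ = subst (2 ≤_) (sym length-w′) 2≤n
    ; h = h ; k = k ; h-∈ = h-∈ ; k-∈ = k-∈ ; h-glue = h-glue ; k-glue = k-glue ; h∘k = h∘k ; k∘h = k∘h }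

  NewPair-no-cancel : ∀ {p q} → NewPair p q → q ≢ inv p
  NewPair-no-cancel ab e = b≢a⁻¹ e
  NewPair-no-cancel cd e = d≢c⁻¹ e
  NewPair-no-cancel d⁻¹y e = y≢ d∈w (trans e (inv-involutive d))
  NewPair-no-cancel ya⁻¹ e = y≢ a∈w (sym (inv-injective e))
  NewPair-no-cancel b⁻¹y⁻¹ e = y≢ b⁻¹∈w (inv-injective e)
  NewPair-no-cancel y⁻¹c⁻¹ e = y⁻¹≢ c∈w (sym (inv-injective e))

  NewPair-no-inv-pair : ∀ {p q} → NewPair p q → ¬ CycAdj (inv q) (inv p) w′
  NewPair-no-inv-pair ab c = y≢ a∈w (inv-injective (CycAdj-functional dist′ b⁻¹·y⁻¹′ c))
  NewPair-no-inv-pair cd c = y≢ c⁻¹∈w (CycAdj-functional dist′ d⁻¹·y′ c)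
  NewPair-no-inv-pair d⁻¹y c = d≢c⁻¹ (sym (inv-moveˡ (inv-injective (CycAdj-functional dist′ y⁻¹·c⁻¹′ c))))
  NewPair-no-inv-pair ya⁻¹ c =
    y⁻¹≢ b∈w (sym (CycAdj-functional dist′ a·b′ (CycAdj-resp (sym (inv-involutive a)) refl c)))
  NewPair-no-inv-pair b⁻¹y⁻¹ c = b≢a⁻¹ (sym (CycAdj-functional dist′ y·a⁻¹′ (CycAdj-inv²⁻ c)))
  NewPair-no-inv-pair y⁻¹c⁻¹ c = y≢ d∈w (sym (CycAdj-functional dist′ c·d′ (CycAdj-inv²⁻ c)))

  W′ : IsWicks w′
  W′ = record { inverse-once = inverse-once′ ; no-cancel = no-cancel′ ; no-inv-pair = no-inv-pair′ }
    where
    no-cancel′ : ∀ l → ¬ CycAdj l (inv l) w′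
    no-cancel′ l c with CycAdj-w′⇒w c
    ... | inj₁ new = NewPair-no-cancel new refl
    ... | inj₂ c₀ = no-cancel l c₀
    no-inv-pair′ : ∀ l m → CycAdj l m w′ → ¬ CycAdj (inv m) (inv l) w′
    no-inv-pair′ l m c c′ with CycAdj-w′⇒w c | CycAdj-w′⇒w c′
    ... | inj₁ new | _ = NewPair-no-inv-pair new c′
    ... | inj₂ _ | inj₁ new = NewPair-no-inv-pair new (CycAdj-inv²⁺ c)
    ... | inj₂ c₀ | inj₂ c₀′ = IsWicks.no-inv-pair W l m c₀ c₀′

  maximal : MaxWicks g w′
  maximal = MaxWicks-transport g MW W′ matching length-w′

-- Relabelling letters

data Orbit (p q m : Letter) : Set where
  is-p : m ≡ p → Orbit p q m
  is-q : m ≢ p → m ≡ q → Orbit p q m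
  is-p⁻¹ : m ≢ p → m ≢ q → m ≡ inv p → Orbit p q m
  is-q⁻¹ : m ≢ p → m ≢ q → m ≢ inv p → m ≡ inv q → Orbit p q m
  other : m ≢ p → m ≢ q → m ≢ inv p → m ≢ inv q → Orbit p q m

orbit : ∀ p q m → Orbit p q m
orbit p q m with m ≟L p | m ≟L q | m ≟L inv p | m ≟L inv q
... | yes e | _ | _ | _ = is-p e
... | no n₁ | yes e | _ | _ = is-q n₁ e
... | no n₁ | no n₂ | yes e | _ = is-p⁻¹ n₁ n₂ e
... | no n₁ | no n₂ | no n₃ | yes e = is-q⁻¹ n₁ n₂ n₃ e
... | no n₁ | no n₂ | no n₃ | no n₄ = other n₁ n₂ n₃ n₄

-- Opaque: unfolding it inside goals makes checking the relabellings below very slow.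
opaque
  transpose : Letter → Letter → Letter → Letter
  transpose p q m with orbit p q m
  ... | is-p _ = q
  ... | is-q _ _ = p
  ... | is-p⁻¹ _ _ _ = inv q
  ... | is-q⁻¹ _ _ _ _ = inv p
  ... | other _ _ _ _ = m

module Transposition (p q : Letter) (p≢q : p ≢ q) (p≢q⁻¹ : p ≢ inv q) where

  opaque
    unfolding transpose

    transpose-p : transpose p q p ≡ q
    transpose-p with orbit p q p
    ... | is-p _ = refl
    ... | is-q n _ = ⊥-elim (n refl)
    ... | is-p⁻¹ n _ _ = ⊥-elim (n refl)
    ... | is-q⁻¹ n _ _ _ = ⊥-elim (n refl)
    ... | other n _ _ _ = ⊥-elim (n refl)

    transpose-q : transpose p q q ≡ p
    transpose-q with orbit p q q
    ... | is-p e = ⊥-elim (p≢q (sym e))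
    ... | is-q _ _ = refl
    ... | is-p⁻¹ _ n _ = ⊥-elim (n refl)
    ... | is-q⁻¹ _ n _ _ = ⊥-elim (n refl)
    ... | other _ n _ _ = ⊥-elim (n refl)

    transpose-p⁻¹ : transpose p q (inv p) ≡ inv q
    transpose-p⁻¹ with orbit p q (inv p)
    ... | is-p e = ⊥-elim (≢-inv p (sym e))
    ... | is-q _ e = ⊥-elim (p≢q⁻¹ (inv-moveʳ e))
    ... | is-p⁻¹ _ _ _ = refl
    ... | is-q⁻¹ _ _ n _ = ⊥-elim (n refl)
    ... | other _ _ n _ = ⊥-elim (n refl)

    transpose-q⁻¹ : transpose p q (inv q) ≡ inv p
    transpose-q⁻¹ with orbit p q (inv q)
    ... | is-p e = ⊥-elim (p≢q⁻¹ (sym e))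
    ... | is-q _ e = ⊥-elim (≢-inv q (sym e))
    ... | is-p⁻¹ _ _ e = ⊥-elim (p≢q (sym (inv-injective e)))
    ... | is-q⁻¹ _ _ _ _ = refl
    ... | other _ _ _ n = ⊥-elim (n refl)

    transpose-other : ∀ {m} → m ≢ p → m ≢ q → m ≢ inv p → m ≢ inv q → transpose p q m ≡ m
    transpose-other {m} n₁ n₂ n₃ n₄ with orbit p q m
    ... | is-p e = ⊥-elim (n₁ e)
    ... | is-q _ e = ⊥-elim (n₂ e)
    ... | is-p⁻¹ _ _ e = ⊥-elim (n₃ e)
    ... | is-q⁻¹ _ _ _ e = ⊥-elim (n₄ e)
    ... | other _ _ _ _ = refl

    transpose-involutive : ∀ m → transpose p q (transpose p q m) ≡ m
    transpose-involutive m with orbit p q m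
    ... | is-p refl = transpose-q
    ... | is-q _ refl = transpose-p
    ... | is-p⁻¹ _ _ refl = transpose-q⁻¹
    ... | is-q⁻¹ _ _ _ refl = transpose-p⁻¹
    ... | other n₁ n₂ n₃ n₄ = transpose-other n₁ n₂ n₃ n₄

    transpose-inv : ∀ m → transpose p q (inv m) ≡ inv (transpose p q m)
    transpose-inv m with orbit p q m
    ... | is-p refl = transpose-p⁻¹
    ... | is-q _ refl = transpose-q⁻¹
    ... | is-p⁻¹ _ _ refl =
      trans (cong (transpose p q) (inv-involutive p)) (trans transpose-p (sym (inv-involutive q)))
    ... | is-q⁻¹ _ _ _ refl =
      trans (cong (transpose p q) (inv-involutive q)) (trans transpose-q (sym (inv-involutive p)))
    ... | other n₁ n₂ n₃ n₄ =
      transpose-other (n₃ ∘ inv-moveʳ) (n₄ ∘ inv-moveʳ) (n₁ ∘ inv-injective) (n₂ ∘ inv-injective)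

record Relabelling : Set where
  field
    to from : Letter → Letter
    from∘to : ∀ m → from (to m) ≡ m
    to∘from : ∀ m → to (from m) ≡ m
    to-inv : ∀ m → to (inv m) ≡ inv (to m)

  from-inv : ∀ m → from (inv m) ≡ inv (from m)
  from-inv m = begin
    from (inv m)                 ≡⟨ cong (from ∘ inv) (sym (to∘from m)) ⟩
    from (inv (to (from m)))     ≡⟨ cong from (sym (to-inv (from m))) ⟩
    from (to (inv (from m)))     ≡⟨ from∘to (inv (from m)) ⟩
    inv (from m)                 ∎
    where open ≡-Reasoning

  to-injective : Injective _≡_ _≡_ to
  to-injective {a} {b} e = trans (sym (from∘to a)) (trans (cong from e) (from∘to b))

  δ-map : ∀ l z → δ l (to z) ≡ δ (from l) z
  δ-map l z = by-cases (z ≟L from l)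
    where
    by-cases : Dec (z ≡ from l) → δ l (to z) ≡ δ (from l) z
    by-cases (yes refl) = trans (cong (δ l) (to∘from l)) (trans (δ-refl l) (sym (δ-refl (from l))))
    by-cases (no z≢) = trans (δ-≢ (λ e → z≢ (trans (sym (from∘to z)) (cong from e)))) (sym (δ-≢ z≢))

  occ-map : ∀ l w → occ l (map to w) ≡ occ (from l) w
  occ-map l [] = refl
  occ-map l (z ∷ w) =
    trans (occ-∷ l (to z) (map to w)) (trans (cong₂ _+_ (δ-map l z) (occ-map l w)) (sym (occ-∷ (from l) z w)))

Adj-map⁻ : ∀ (f : Letter → Letter) (Z : Word) {p q} → Adj (map f Z) p q →
           ∃₂ λ p′ q′ → Adj Z p′ q′ × f p′ ≡ p × f q′ ≡ q
Adj-map⁻ f (z ∷ z′ ∷ t) hd = z , z′ , hd , refl , refl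
Adj-map⁻ f (z ∷ z′ ∷ t) (tl a) with Adj-map⁻ f (z′ ∷ t) a
... | p′ , q′ , b , e₁ , e₂ = p′ , q′ , tl b , e₁ , e₂
Adj-map⁻ f (z ∷ []) (tl ())

CycAdj-map⁻ : ∀ (f : Letter → Letter) (w : Word) → 2 ≤ length w → ∀ {p q} → CycAdj p q (map f w) →
              ∃₂ λ p′ q′ → CycAdj p′ q′ w × f p′ ≡ p × f q′ ≡ q
CycAdj-map⁻ f (z ∷ z′ ∷ t) 2≤n {p} {q} c
  with Adj-map⁻ f ((z ∷ z′ ∷ t) ++ [ z ])
         (subst (λ Z → Adj Z p q) (sym (map-++ f (z ∷ z′ ∷ t) [ z ])) (CycAdj⇒Adj (map f (z ∷ z′ ∷ t)) c))
... | p′ , q′ , a , e₁ , e₂ = p′ , q′ , Adj-closed⇒CycAdj z (z′ ∷ t) (λ ()) a , e₁ , e₂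
CycAdj-map⁻ f (z ∷ []) (s≤s ()) c

CycAdj-map⁺ : ∀ (f : Letter → Letter) {w p q} → CycAdj p q w → CycAdj (f p) (f q) (map f w)
CycAdj-map⁺ f (r , t , (P , S , refl , refl) , e) =
  map f S ++ map f P , map f t , (map f P , map f S , map-++ f P S , refl) ,
  trans (sym (map-++ f S P)) (cong (map f) e)

module _ (φ : Relabelling) {g w w′} (w′~φw : Rot w′ (map (Relabelling.to φ) w)) (MW : MaxWicks g w)
         (2≤n : 2 ≤ length w) where
  open Relabelling φ

  private
    W : IsWicks w
    W = proj₁ MW

    dist : Distinct w
    dist = Wicks⇒Distinct W

    inv∈ : InvClosed w
    inv∈ = Wicks⇒InvClosed W

    occ-w′ : ∀ l → occ l w′ ≡ occ (from l) w
    occ-w′ l = trans (occ-Rot w′~φw l) (occ-map l w)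

    from-∈ : ∀ {l} → l ∈ w′ → from l ∈ w
    from-∈ {l} l∈w′ with ∈⇒occ-suc l∈w′
    ... | k , e = occ-suc⇒∈ (trans (sym (occ-w′ l)) e)

    to-∈ : ∀ {l} → l ∈ w → to l ∈ w′
    to-∈ {l} l∈w with ∈⇒occ-suc l∈w
    ... | k , e = occ-suc⇒∈ (trans (occ-w′ (to l)) (trans (cong (λ z → occ z w) (from∘to l)) e))

    length-w′ : length w′ ≡ length w
    length-w′ = trans (Length.μ-Rot w′~φw) (length-map to w)

    CycAdj-from : ∀ {p q} → CycAdj p q w′ → CycAdj (from p) (from q) w
    CycAdj-from c with CycAdj-map⁻ to w 2≤n (CycFactor-Rot w′~φw c)
    ... | p′ , q′ , c′ , refl , refl = subst₂ (λ u v → CycAdj u v w) (sym (from∘to p′)) (sym (from∘to q′)) c′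

    CycAdj-to : ∀ {p q} → CycAdj p q w → CycAdj (to p) (to q) w′
    CycAdj-to c = CycFactor-Rot (Rot-sym w′~φw) (CycAdj-map⁺ to c)

    dist′ : Distinct w′
    dist′ l l∈w′ = trans (occ-w′ l) (dist (from l) (from-∈ l∈w′))

    inv∈′ : InvClosed w′
    inv∈′ l l∈w′ =
      subst (_∈ w′) (trans (cong to (sym (from-inv l))) (to∘from (inv l))) (to-∈ (inv∈ (from l) (from-∈ l∈w′)))

    W′ : IsWicks w′
    W′ = record
      { inverse-once = λ l l∈w′ → dist′ (inv l) (inv∈′ l l∈w′)
      ; no-cancel = λ l c → IsWicks.no-cancel W (from l) (CycAdj-resp refl (sym (from-inv l)) (CycAdj-from c))
      ; no-inv-pair = λ l m c c′ → IsWicks.no-inv-pair W (from l) (from m) (CycAdj-from c)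
          (subst₂ (λ u v → CycAdj u v w) (from-inv m) (from-inv l) (CycAdj-from c′)) }

    matching : VertexMatching w w′
    matching = record
      { dist = dist ; inv∈ = inv∈ ; dist′ = dist′ ; inv∈′ = inv∈′
      ; 2≤n = 2≤n ; 2≤n′ = subst (2 ≤_) (sym length-w′) 2≤n
      ; h = from ; k = to ; h-∈ = λ _ → from-∈ ; k-∈ = λ _ → to-∈
      ; h-glue = λ {m} g → Glue⇒Glued (CycAdj-resp (sym (from-inv m)) refl (CycAdj-from g))
      ; k-glue = λ {m} g → Glue⇒Glued (CycAdj-resp (sym (to-inv m)) refl (CycAdj-to g))
      ; h∘k = λ m _ → ≡⇒Glued (sym (from∘to m))
      ; k∘h = λ m _ → ≡⇒Glued (sym (to∘from m)) }

  MaxWicks-relabel : MaxWicks g w′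
  MaxWicks-relabel = MaxWicks-transport g MW W′ matching length-w′

transposition : ∀ p q → p ≢ q → p ≢ inv q → Relabelling
transposition p q p≢q p≢q⁻¹ = record
  { to = transpose p q ; from = transpose p q
  ; from∘to = transpose-involutive ; to∘from = transpose-involutive ; to-inv = transpose-inv }
  where open Transposition p q p≢q p≢q⁻¹

_∘ᴿ_ : Relabelling → Relabelling → Relabelling
φ ∘ᴿ ψ = record
  { to = φ.to ∘ ψ.to ; from = ψ.from ∘ φ.from
  ; from∘to = λ m → trans (cong ψ.from (φ.from∘to (ψ.to m))) (ψ.from∘to m)
  ; to∘from = λ m → trans (cong φ.to (ψ.to∘from (φ.from m))) (φ.to∘from m)
  ; to-inv = λ m → trans (cong φ.to (ψ.to-inv m)) (φ.to-inv (ψ.to m)) }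
  where
  module φ = Relabelling φ
  module ψ = Relabelling ψ

Adj-⊆⇒≡ : ∀ m (tA tB : Word) → Distinct (m ∷ tA) → Distinct (m ∷ tB) → length tA ≡ length tB →
          (∀ {p q} → Adj (m ∷ tA) p q → Adj (m ∷ tB) p q) → tA ≡ tB
Adj-⊆⇒≡ m [] [] distA distB e ⊆ = refl
Adj-⊆⇒≡ m (n ∷ tA) tB distA distB e ⊆ with ⊆ (hd {m} {n} {tA})
... | tl a = ⊥-elim (Distinct-head distB (proj₁ (Adj⇒∈ a)))
... | hd {t = tB′} =
  cong (n ∷_) (Adj-⊆⇒≡ n tA tB′ (Distinct-tail distA) (Distinct-tail distB) (suc-injective e) ⊆′)
  where
  ⊆′ : ∀ {p q} → Adj (n ∷ tA) p q → Adj (n ∷ tB′) p q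
  ⊆′ a with ⊆ (tl a)
  ... | hd = ⊥-elim (Distinct-head distA (proj₁ (Adj⇒∈ a)))
  ... | tl b = b

CycAdj-⊆⇒Rot : ∀ (A B : Word) → Distinct A → Distinct B → length A ≡ length B → 2 ≤ length A →
               (∀ {p q} → CycAdj p q A → CycAdj p q B) → Rot B A
CycAdj-⊆⇒Rot (m ∷ z ∷ tA) B distA distB e 2≤n ⊆ with ∈-∃++ (proj₁ (CycAdj⇒∈ (⊆ (Adj⇒CycAdj (hd {m} {z} {tA})))))
... | P , S , refl = subst (Rot B) (cong (m ∷_) (sym tA≡)) R
  where
  R : Rot B (m ∷ S ++ P)
  R = Rot-++-∷ P m S
  ⊆′ : ∀ {p q} → Adj (m ∷ z ∷ tA) p q → Adj (m ∷ S ++ P) p q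
  ⊆′ {p} {q} a with Adj-++⁻ (m ∷ S ++ P) [ m ] (CycAdj⇒Adj (m ∷ S ++ P) (CycFactor-Rot R (⊆ (Adj⇒CycAdj a))))
  ... | inj₁ b = b
  ... | inj₂ (inj₁ b) = ⊥-elim (¬Adj-[ m ] b)
  ... | inj₂ (inj₂ (_ , (B′ , refl))) = ⊥-elim (Distinct-head distA (Adj-∷⇒snd∈ a))
  tA≡ : z ∷ tA ≡ S ++ P
  tA≡ = Adj-⊆⇒≡ m (z ∷ tA) (S ++ P) distA (Distinct-Rot R distB) (suc-injective (trans e (Length.μ-Rot R))) ⊆′
CycAdj-⊆⇒Rot (m ∷ []) B distA distB e (s≤s ()) ⊆

-- Type 2 transformations

cycle₃ : Letter → Letter → Letter → Letter → Letter
cycle₃ s x y = transpose s x ∘ transpose s y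

module Cycle₃ (s x y : Letter) (s≢x : s ≢ x) (s≢x⁻¹ : s ≢ inv x) (s≢y : s ≢ y) (s≢y⁻¹ : s ≢ inv y)
              (x≢y : x ≢ y) (x≢y⁻¹ : x ≢ inv y) where
  private
    module X = Transposition s x s≢x s≢x⁻¹
    module Y = Transposition s y s≢y s≢y⁻¹

  relabelling : Relabelling
  relabelling = transposition s x s≢x s≢x⁻¹ ∘ᴿ transposition s y s≢y s≢y⁻¹

  open Relabelling relabelling public using (to-inv; to-injective)

  cycle-s : cycle₃ s x y s ≡ y
  cycle-s = trans (cong (transpose s x) Y.transpose-p)
                  (X.transpose-other (s≢y ∘ sym) (x≢y ∘ sym) (s≢y⁻¹ ∘ sym ∘ inv-moveˡ) (x≢y⁻¹ ∘ sym ∘ inv-moveˡ))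

  cycle-x : cycle₃ s x y x ≡ s
  cycle-x = trans (cong (transpose s x) (Y.transpose-other (s≢x ∘ sym) x≢y (s≢x⁻¹ ∘ sym ∘ inv-moveˡ) x≢y⁻¹))
                  X.transpose-q

  cycle-inv : ∀ {m n} → cycle₃ s x y m ≡ n → cycle₃ s x y (inv m) ≡ inv n
  cycle-inv {m} e = trans (to-inv m) (cong inv e)

  cycle-fix : ∀ {m} → m ≢ s → m ≢ x → m ≢ y → m ≢ inv s → m ≢ inv x → m ≢ inv y → cycle₃ s x y m ≡ m
  cycle-fix m≢s m≢x m≢y m≢s⁻¹ m≢x⁻¹ m≢y⁻¹ =
    trans (cong (transpose s x) (Y.transpose-other m≢s m≢y m≢s⁻¹ m≢y⁻¹)) (X.transpose-other m≢s m≢x m≢s⁻¹ m≢x⁻¹)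

head-of? : ∀ p (L : List (Letter × Letter)) → (∃[ q ] (p , q) ∈ L) ⊎ (∀ q → (p , q) ∉ L)
head-of? p [] = inj₂ (λ q ())
head-of? p ((p′ , q′) ∷ L) with p′ ≟L p | head-of? p L
... | yes refl | _ = inj₁ (q′ , here refl)
... | no _ | inj₁ (q , m) = inj₁ (q , there m)
... | no p′≢p | inj₂ n = inj₂ (λ q → λ { (here e) → p′≢p (sym (cong proj₁ e)) ; (there m) → n q m })

tail-of? : ∀ q (L : List (Letter × Letter)) → (∃[ p ] (p , q) ∈ L) ⊎ (∀ p → (p , q) ∉ L)
tail-of? q [] = inj₂ (λ p ())
tail-of? q ((p′ , q′) ∷ L) with q′ ≟L q | tail-of? q L
... | yes refl | _ = inj₁ (p′ , here refl)
... | no _ | inj₁ (p , m) = inj₁ (p , there m)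
... | no q′≢q | inj₂ n = inj₂ (λ p → λ { (here e) → q′≢q (sym (cong proj₂ e)) ; (there m) → n p m })

-- Ps lists adjacencies of w covering both replaced blocks and every occurrence of s^± and x^±;
-- the relabelling s ↦ y ↦ x ↦ s carries them into w′ and fixes every other adjacency of w.
module Type2 (g : ℕ) (w w₁ w′ : Word) (s x y : Letter) (MW : MaxWicks g w) (x∈w : x ∈ w) (fresh : Fresh y w)
  (s∈w : s ∈ w) (s≢x : s ≢ x) (s≢x⁻¹ : s ≢ inv x)
  (u₁ u₂ : Word)
  (forth₁ : Inherits w u₁ w₁) (forth₂ : Inherits w₁ u₂ w′)
  (Ps : List (Letter × Letter))
  (Ps⊆w : ∀ {p q} → (p , q) ∈ Ps → CycAdj p q w)
  (Ps↦w′ : ∀ {p q} → (p , q) ∈ Ps → CycAdj (cycle₃ s x y p) (cycle₃ s x y q) w′)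
  (u₁⊆Ps : ∀ {p q} → Adj u₁ p q → (p , q) ∈ Ps)
  (u₂⊆Ps : ∀ {p q} → Adj u₂ p q → (p , q) ∈ Ps)
  (heads : ∀ {m} → m ∈ s ∷ x ∷ inv s ∷ inv x ∷ [] → ∃[ q ] (m , q) ∈ Ps)
  (tails : ∀ {m} → m ∈ s ∷ x ∷ inv s ∷ inv x ∷ [] → ∃[ p ] (p , m) ∈ Ps)
  (dist′ : Distinct w′) (length-w′ : length w′ ≡ length w) where

  private
    open WicksSetting g MW fresh
    open Cycle₃ s x y s≢x s≢x⁻¹ (y≢ s∈w ∘ sym) (y⁻¹≢ s∈w ∘ sym) (y≢ x∈w ∘ sym) (y⁻¹≢ x∈w ∘ sym)

    2≤n : 2 ≤ length w
    2≤n = Wicks⇒2≤length W x∈w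

    φ : Letter → Letter
    φ = cycle₃ s x y

    fixed : ∀ {m} → m ∈ w → (∀ {z} → z ∈ s ∷ x ∷ inv s ∷ inv x ∷ [] → m ≢ z) → φ m ≡ m
    fixed m∈w ≢sx =
      cycle-fix (≢sx (here refl)) (≢sx (there (here refl))) (y≢ m∈w ∘ sym)
                (≢sx (there (there (here refl)))) (≢sx (there (there (there (here refl))))) (y⁻¹≢ m∈w ∘ sym)

    CycAdj-φ : ∀ {p q} → CycAdj p q w → CycAdj (φ p) (φ q) w′
    CycAdj-φ {p} {q} c with head-of? p Ps
    ... | inj₁ (q′ , pq′∈) =
      subst (λ z → CycAdj (φ p) (φ z) w′) (CycAdj-functional dist (Ps⊆w pq′∈) c) (Ps↦w′ pq′∈)
    ... | inj₂ not-head with tail-of? q Ps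
    ...   | inj₁ (p′ , p′q∈) =
      ⊥-elim (not-head q (subst (λ z → (z , q) ∈ Ps) (CycAdj-injective dist (Ps⊆w p′q∈) c) p′q∈))
    ...   | inj₂ not-tail with forth₁ c
    ...     | inj₁ a = ⊥-elim (not-head q (u₁⊆Ps a))
    ...     | inj₂ c₁ with forth₂ c₁
    ...       | inj₁ a = ⊥-elim (not-head q (u₂⊆Ps a))
    ...       | inj₂ c′ = CycAdj-resp (fixed (proj₁ (CycAdj⇒∈ c)) p≢) (fixed (proj₂ (CycAdj⇒∈ c)) q≢) c′
      where
      p≢ : ∀ {z} → z ∈ s ∷ x ∷ inv s ∷ inv x ∷ [] → p ≢ z
      p≢ z∈ refl = not-head _ (proj₂ (heads z∈))
      q≢ : ∀ {z} → z ∈ s ∷ x ∷ inv s ∷ inv x ∷ [] → q ≢ z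
      q≢ z∈ refl = not-tail _ (proj₂ (tails z∈))

    φw-distinct : Distinct (map φ w)
    φw-distinct l l∈φw with ∈⇒occ-suc l∈φw
    ... | k , e = trans (occ-map l w) (dist (from l) (occ-suc⇒∈ (trans (sym (occ-map l w)) e)))
      where open Relabelling relabelling using (from; occ-map)

    w′~φw : Rot w′ (map φ w)
    w′~φw = CycAdj-⊆⇒Rot (map φ w) w′ φw-distinct dist′ (trans (length-map φ w) (sym length-w′))
      (subst (2 ≤_) (sym (length-map φ w)) 2≤n) φw⊆w′
      where
      φw⊆w′ : ∀ {p q} → CycAdj p q (map φ w) → CycAdj p q w′
      φw⊆w′ c with CycAdj-map⁻ φ w 2≤n c
      ... | p′ , q′ , c′ , refl , refl = CycAdj-φ c′

  equivalent : Equivalent w′ w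
  equivalent = φ , to-injective , to-inv , w′~φw

  maximal : MaxWicks g w′
  maximal = MaxWicks-relabel relabelling {g} w′~φw MW 2≤n

module Type2a (g : ℕ) (w w′ : Word) (x y : Letter) (MW : MaxWicks g w) (x∈w : x ∈ w) (fresh : Fresh y w)
  (a b d : Letter) (w₁ : Word)
  (axb : CycFactor (a ∷ x ∷ b ∷ []) w) (a⁻¹x⁻¹d : CycFactor (inv a ∷ inv x ∷ d ∷ []) w)
  (R₁ : Replace (inv b ∷ a ∷ x ∷ b ∷ []) (inv b ∷ y ∷ a ∷ b ∷ []) w w₁)
  (R₂ : Replace (inv d ∷ inv a ∷ inv x ∷ d ∷ []) (inv d ∷ inv y ∷ inv a ∷ d ∷ []) w₁ w′) where

  open WicksSetting g MW fresh

  back₁ : Inherits w₁ (inv b ∷ y ∷ a ∷ b ∷ []) w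
  back₁ = CycAdj-Replace⁻ (inv b) b (a ∷ x ∷ []) (y ∷ a ∷ []) R₁
  forth₁ : Inherits w (inv b ∷ a ∷ x ∷ b ∷ []) w₁
  forth₁ = CycAdj-Replace⁻ (inv b) b (y ∷ a ∷ []) (a ∷ x ∷ []) (Replace-sym R₁)
  forth₂ : Inherits w₁ (inv d ∷ inv a ∷ inv x ∷ d ∷ []) w′
  forth₂ = CycAdj-Replace⁻ (inv d) d (inv y ∷ inv a ∷ []) (inv a ∷ inv x ∷ []) (Replace-sym R₂)

  b⁻¹·a : CycAdj (inv b) a w
  b⁻¹·a = CycAdj-Replace⁺ (Replace-sym R₁) hd
  a·x : CycAdj a x w
  a·x = CycAdj-Replace⁺ (Replace-sym R₁) (tl hd)
  x·b : CycAdj x b w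
  x·b = CycAdj-Replace⁺ (Replace-sym R₁) (tl (tl hd))
  a⁻¹·x⁻¹ : CycAdj (inv a) (inv x) w
  a⁻¹·x⁻¹ = CycFactor⇒CycAdj a⁻¹x⁻¹d
  x⁻¹·d : CycAdj (inv x) d w
  x⁻¹·d = CycFactor⇒CycAdj (CycFactor-tail a⁻¹x⁻¹d)

  a∈w : a ∈ w
  a∈w = proj₁ (CycAdj⇒∈ a·x)
  b∈w : b ∈ w
  b∈w = proj₂ (CycAdj⇒∈ x·b)
  d∈w : d ∈ w
  d∈w = proj₂ (CycAdj⇒∈ x⁻¹·d)
  a⁻¹∈w : inv a ∈ w
  a⁻¹∈w = inv∈ a a∈w
  x⁻¹∈w : inv x ∈ w
  x⁻¹∈w = inv∈ x x∈w
  d⁻¹∈w : inv d ∈ w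
  d⁻¹∈w = inv∈ d d∈w

  b≢a⁻¹ : b ≢ inv a
  b≢a⁻¹ e = ¬CycAdj-self dist (CycAdj-resp (sym (inv-moveˡ e)) refl b⁻¹·a)
  a≢x : a ≢ x
  a≢x refl = ¬CycAdj-self dist a·x
  a≢x⁻¹ : a ≢ inv x
  a≢x⁻¹ refl = no-cancel (inv x) (CycAdj-resp refl (inv-involutive x) a·x)

  -- The adjacency d⁻¹a⁻¹ rewritten by R₂ is not among those created by R₁, so it already occurs in w.
  d⁻¹·a⁻¹ : CycAdj (inv d) (inv a) w
  d⁻¹·a⁻¹ with back₁ (CycAdj-Replace⁺ (Replace-sym R₂) hd)
  ... | inj₁ a′ with Adj-quadruple a′
  ...   | inj₁ (_ , e₂) = ⊥-elim (y≢ a⁻¹∈w (sym e₂))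
  ...   | inj₂ (inj₁ (e₁ , _)) = ⊥-elim (y≢ d⁻¹∈w (sym e₁))
  ...   | inj₂ (inj₂ (_ , e₂)) = ⊥-elim (b≢a⁻¹ (sym e₂))
  d⁻¹·a⁻¹ | inj₂ c = c

  b≢a : b ≢ a
  b≢a refl = no-cancel (inv b) (CycAdj-resp refl (inv-involutive b) b⁻¹·a)
  b≢x : b ≢ x
  b≢x refl = ¬CycAdj-self dist x·b
  b≢x⁻¹ : b ≢ inv x
  b≢x⁻¹ refl = no-cancel x x·b
  d≢a : d ≢ a
  d≢a refl = ¬CycAdj-self dist d⁻¹·a⁻¹
  d≢x : d ≢ x
  d≢x refl = no-cancel (inv d) (CycAdj-resp refl (inv-involutive d) x⁻¹·d)
  d≢a⁻¹ : d ≢ inv a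
  d≢a⁻¹ e = no-cancel a (CycAdj-resp (sym (inv-moveˡ e)) refl d⁻¹·a⁻¹)
  d≢x⁻¹ : d ≢ inv x
  d≢x⁻¹ refl = ¬CycAdj-self dist x⁻¹·d

  open Cycle₃ a x y a≢x a≢x⁻¹ (y≢ a∈w ∘ sym) (y⁻¹≢ a∈w ∘ sym) (y≢ x∈w ∘ sym) (y⁻¹≢ x∈w ∘ sym)

  fix-b : cycle₃ a x y b ≡ b
  fix-b = cycle-fix b≢a b≢x (y≢ b∈w ∘ sym) b≢a⁻¹ b≢x⁻¹ (y⁻¹≢ b∈w ∘ sym)
  fix-d : cycle₃ a x y d ≡ d
  fix-d = cycle-fix d≢a d≢x (y≢ d∈w ∘ sym) d≢a⁻¹ d≢x⁻¹ (y⁻¹≢ d∈w ∘ sym)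

  b⁻¹·y′ : CycAdj (inv b) y w′
  b⁻¹·y′ with forth₂ (CycAdj-Replace⁺ R₁ hd)
  ... | inj₁ a′ with Adj-quadruple a′
  ...   | inj₁ (_ , e₂) = ⊥-elim (y≢ a⁻¹∈w e₂)
  ...   | inj₂ (inj₁ (_ , e₂)) = ⊥-elim (y≢ x⁻¹∈w e₂)
  ...   | inj₂ (inj₂ (_ , e₂)) = ⊥-elim (y≢ d∈w e₂)
  b⁻¹·y′ | inj₂ c = c
  y·a′ : CycAdj y a w′
  y·a′ with forth₂ (CycAdj-Replace⁺ R₁ (tl hd))
  ... | inj₁ a′ with Adj-quadruple a′
  ...   | inj₁ (e₁ , _) = ⊥-elim (y≢ d⁻¹∈w e₁)
  ...   | inj₂ (inj₁ (e₁ , _)) = ⊥-elim (y≢ a⁻¹∈w e₁)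
  ...   | inj₂ (inj₂ (e₁ , _)) = ⊥-elim (y≢ x⁻¹∈w e₁)
  y·a′ | inj₂ c = c
  a·b′ : CycAdj a b w′
  a·b′ with forth₂ (CycAdj-Replace⁺ R₁ (tl (tl hd)))
  ... | inj₁ a′ with Adj-quadruple a′
  ...   | inj₁ (_ , e₂) = ⊥-elim (b≢a⁻¹ e₂)
  ...   | inj₂ (inj₁ (e₁ , _)) = ⊥-elim (≢-inv a e₁)
  ...   | inj₂ (inj₂ (e₁ , _)) = ⊥-elim (a≢x⁻¹ e₁)
  a·b′ | inj₂ c = c
  d⁻¹·y⁻¹′ : CycAdj (inv d) (inv y) w′
  d⁻¹·y⁻¹′ = CycAdj-Replace⁺ R₂ hd
  y⁻¹·a⁻¹′ : CycAdj (inv y) (inv a) w′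
  y⁻¹·a⁻¹′ = CycAdj-Replace⁺ R₂ (tl hd)
  a⁻¹·d′ : CycAdj (inv a) d w′
  a⁻¹·d′ = CycAdj-Replace⁺ R₂ (tl (tl hd))

  Ps : List (Letter × Letter)
  Ps = (inv b , a) ∷ (a , x) ∷ (x , b) ∷ (inv d , inv a) ∷ (inv a , inv x) ∷ (inv x , d) ∷ []

  Ps⊆w : ∀ {p q} → (p , q) ∈ Ps → CycAdj p q w
  Ps⊆w (here refl) = b⁻¹·a
  Ps⊆w (there (here refl)) = a·x
  Ps⊆w (there (there (here refl))) = x·b
  Ps⊆w (there (there (there (here refl)))) = d⁻¹·a⁻¹
  Ps⊆w (there (there (there (there (here refl))))) = a⁻¹·x⁻¹
  Ps⊆w (there (there (there (there (there (here refl)))))) = x⁻¹·d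

  Ps↦w′ : ∀ {p q} → (p , q) ∈ Ps → CycAdj (cycle₃ a x y p) (cycle₃ a x y q) w′
  Ps↦w′ (here refl) = CycAdj-resp (cycle-inv fix-b) cycle-s b⁻¹·y′
  Ps↦w′ (there (here refl)) = CycAdj-resp cycle-s cycle-x y·a′
  Ps↦w′ (there (there (here refl))) = CycAdj-resp cycle-x fix-b a·b′
  Ps↦w′ (there (there (there (here refl)))) = CycAdj-resp (cycle-inv fix-d) (cycle-inv cycle-s) d⁻¹·y⁻¹′
  Ps↦w′ (there (there (there (there (here refl))))) = CycAdj-resp (cycle-inv cycle-s) (cycle-inv cycle-x) y⁻¹·a⁻¹′
  Ps↦w′ (there (there (there (there (there (here refl)))))) = CycAdj-resp (cycle-inv cycle-x) fix-d a⁻¹·d′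

  u₁⊆Ps : ∀ {p q} → Adj (inv b ∷ a ∷ x ∷ b ∷ []) p q → (p , q) ∈ Ps
  u₁⊆Ps a′ with Adj-quadruple a′
  ... | inj₁ (refl , refl) = here refl
  ... | inj₂ (inj₁ (refl , refl)) = there (here refl)
  ... | inj₂ (inj₂ (refl , refl)) = there (there (here refl))

  u₂⊆Ps : ∀ {p q} → Adj (inv d ∷ inv a ∷ inv x ∷ d ∷ []) p q → (p , q) ∈ Ps
  u₂⊆Ps a′ with Adj-quadruple a′
  ... | inj₁ (refl , refl) = there (there (there (here refl)))
  ... | inj₂ (inj₁ (refl , refl)) = there (there (there (there (here refl))))
  ... | inj₂ (inj₂ (refl , refl)) = there (there (there (there (there (here refl)))))

  heads : ∀ {m} → m ∈ a ∷ x ∷ inv a ∷ inv x ∷ [] → ∃[ q ] (m , q) ∈ Ps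
  heads (here refl) = x , there (here refl)
  heads (there (here refl)) = b , there (there (here refl))
  heads (there (there (here refl))) = inv x , there (there (there (there (here refl))))
  heads (there (there (there (here refl)))) = d , there (there (there (there (there (here refl)))))

  tails : ∀ {m} → m ∈ a ∷ x ∷ inv a ∷ inv x ∷ [] → ∃[ p ] (p , m) ∈ Ps
  tails (here refl) = inv b , here refl
  tails (there (here refl)) = a , there (here refl)
  tails (there (there (here refl))) = inv d , there (there (there (here refl)))
  tails (there (there (there (here refl)))) = inv a , there (there (there (there (here refl))))

  removed inserted : Word
  removed = inv b ∷ a ∷ x ∷ b ∷ inv d ∷ inv a ∷ inv x ∷ d ∷ []
  inserted = inv b ∷ y ∷ a ∷ b ∷ inv d ∷ inv y ∷ inv a ∷ d ∷ []

  occ-exchange : ∀ l → occ l w′ + (δ l x + δ l (inv x)) ≡ occ l w + (δ l y + δ l (inv y))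
  occ-exchange = occ-trade w w′ x y removed inserted (λ l → Occ.μ-Replace₂ l R₁ R₂) λ l →
    solve 10 (λ B⁻ A X B D⁻ A⁻ X⁻ D Y Y⁻ →
       (B⁻ :+ (Y :+ (A :+ (B :+ (D⁻ :+ (Y⁻ :+ (A⁻ :+ (D :+ con 0)))))))) :+ (X :+ X⁻)
       := (B⁻ :+ (A :+ (X :+ (B :+ (D⁻ :+ (A⁻ :+ (X⁻ :+ (D :+ con 0)))))))) :+ (Y :+ Y⁻))
       refl (δ l (inv b)) (δ l a) (δ l x) (δ l b) (δ l (inv d)) (δ l (inv a)) (δ l (inv x)) (δ l d)
            (δ l y) (δ l (inv y))

  length-w′ : length w′ ≡ length w
  length-w′ = sym (+-cancelʳ-≡ 8 (length w) (length w′) (Length.μ-Replace₂ R₁ R₂))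

  open Type2 g w w₁ w′ a x y MW x∈w fresh a∈w a≢x a≢x⁻¹ _ _ forth₁ forth₂ Ps Ps⊆w Ps↦w′ u₁⊆Ps u₂⊆Ps heads tails
    (LetterExchange.dist′ w w′ x y dist inv∈ x∈w fresh occ-exchange) length-w′ public using (equivalent; maximal)

module Type2b (g : ℕ) (w w′ : Word) (x y : Letter) (MW : MaxWicks g w) (x∈w : x ∈ w) (fresh : Fresh y w)
  (a b c : Letter) (w₁ : Word)
  (axb : CycFactor (a ∷ x ∷ b ∷ []) w) (cx⁻¹b⁻¹ : CycFactor (c ∷ inv x ∷ inv b ∷ []) w)
  (R₁ : Replace (a ∷ x ∷ b ∷ inv a ∷ []) (a ∷ b ∷ y ∷ inv a ∷ []) w w₁)
  (R₂ : Replace (c ∷ inv x ∷ inv b ∷ inv c ∷ []) (c ∷ inv b ∷ inv y ∷ inv c ∷ []) w₁ w′) where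

  open WicksSetting g MW fresh

  back₁ : Inherits w₁ (a ∷ b ∷ y ∷ inv a ∷ []) w
  back₁ = CycAdj-Replace⁻ a (inv a) (x ∷ b ∷ []) (b ∷ y ∷ []) R₁
  forth₁ : Inherits w (a ∷ x ∷ b ∷ inv a ∷ []) w₁
  forth₁ = CycAdj-Replace⁻ a (inv a) (b ∷ y ∷ []) (x ∷ b ∷ []) (Replace-sym R₁)
  forth₂ : Inherits w₁ (c ∷ inv x ∷ inv b ∷ inv c ∷ []) w′
  forth₂ = CycAdj-Replace⁻ c (inv c) (inv b ∷ inv y ∷ []) (inv x ∷ inv b ∷ []) (Replace-sym R₂)

  a·x : CycAdj a x w
  a·x = CycAdj-Replace⁺ (Replace-sym R₁) hd
  x·b : CycAdj x b w
  x·b = CycAdj-Replace⁺ (Replace-sym R₁) (tl hd)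
  b·a⁻¹ : CycAdj b (inv a) w
  b·a⁻¹ = CycAdj-Replace⁺ (Replace-sym R₁) (tl (tl hd))
  c·x⁻¹ : CycAdj c (inv x) w
  c·x⁻¹ = CycFactor⇒CycAdj cx⁻¹b⁻¹
  x⁻¹·b⁻¹ : CycAdj (inv x) (inv b) w
  x⁻¹·b⁻¹ = CycFactor⇒CycAdj (CycFactor-tail cx⁻¹b⁻¹)

  a∈w : a ∈ w
  a∈w = proj₁ (CycAdj⇒∈ a·x)
  b∈w : b ∈ w
  b∈w = proj₂ (CycAdj⇒∈ x·b)
  c∈w : c ∈ w
  c∈w = proj₁ (CycAdj⇒∈ c·x⁻¹)
  b⁻¹∈w : inv b ∈ w
  b⁻¹∈w = inv∈ b b∈w
  c⁻¹∈w : inv c ∈ w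
  c⁻¹∈w = inv∈ c c∈w
  x⁻¹∈w : inv x ∈ w
  x⁻¹∈w = inv∈ x x∈w

  a≢c : a ≢ c
  a≢c refl = ≢-inv x (CycAdj-functional dist a·x c·x⁻¹)

  -- The adjacency b⁻¹c⁻¹ rewritten by R₂ is not among those created by R₁, so it already occurs in w.
  b⁻¹·c⁻¹ : CycAdj (inv b) (inv c) w
  b⁻¹·c⁻¹ with back₁ (CycAdj-Replace⁺ (Replace-sym R₂) (tl (tl hd)))
  ... | inj₁ a′ with Adj-quadruple a′
  ...   | inj₁ (e₁ , e₂) = ⊥-elim (a≢c (sym (trans (inv-moveʳ e₂) e₁)))
  ...   | inj₂ (inj₁ (e₁ , _)) = ⊥-elim (≢-inv b (sym e₁))
  ...   | inj₂ (inj₂ (e₁ , _)) = ⊥-elim (y≢ b⁻¹∈w (sym e₁))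
  b⁻¹·c⁻¹ | inj₂ c′ = c′

  b≢x : b ≢ x
  b≢x refl = ¬CycAdj-self dist x·b
  b≢x⁻¹ : b ≢ inv x
  b≢x⁻¹ refl = no-cancel x x·b
  a≢b : a ≢ b
  a≢b refl = no-cancel a b·a⁻¹
  a≢b⁻¹ : a ≢ inv b
  a≢b⁻¹ e = ¬CycAdj-self dist (CycAdj-resp refl (sym (inv-moveˡ e)) b·a⁻¹)
  a≢x : a ≢ x
  a≢x refl = ¬CycAdj-self dist a·x
  a≢x⁻¹ : a ≢ inv x
  a≢x⁻¹ refl = no-cancel (inv x) (CycAdj-resp refl (inv-involutive x) a·x)
  c≢b : c ≢ b
  c≢b refl = ¬CycAdj-self dist b⁻¹·c⁻¹
  c≢x : c ≢ x
  c≢x refl = no-cancel x c·x⁻¹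
  c≢b⁻¹ : c ≢ inv b
  c≢b⁻¹ refl = no-cancel (inv b) b⁻¹·c⁻¹
  c≢x⁻¹ : c ≢ inv x
  c≢x⁻¹ refl = ¬CycAdj-self dist c·x⁻¹

  open Cycle₃ b x y b≢x b≢x⁻¹ (y≢ b∈w ∘ sym) (y⁻¹≢ b∈w ∘ sym) (y≢ x∈w ∘ sym) (y⁻¹≢ x∈w ∘ sym)

  fix-a : cycle₃ b x y a ≡ a
  fix-a = cycle-fix a≢b a≢x (y≢ a∈w ∘ sym) a≢b⁻¹ a≢x⁻¹ (y⁻¹≢ a∈w ∘ sym)
  fix-c : cycle₃ b x y c ≡ c
  fix-c = cycle-fix c≢b c≢x (y≢ c∈w ∘ sym) c≢b⁻¹ c≢x⁻¹ (y⁻¹≢ c∈w ∘ sym)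

  a·b′ : CycAdj a b w′
  a·b′ with forth₂ (CycAdj-Replace⁺ R₁ hd)
  ... | inj₁ a′ with Adj-quadruple a′
  ...   | inj₁ (e₁ , _) = ⊥-elim (a≢c e₁)
  ...   | inj₂ (inj₁ (e₁ , _)) = ⊥-elim (a≢x⁻¹ e₁)
  ...   | inj₂ (inj₂ (e₁ , _)) = ⊥-elim (a≢b⁻¹ e₁)
  a·b′ | inj₂ c′ = c′
  b·y′ : CycAdj b y w′
  b·y′ with forth₂ (CycAdj-Replace⁺ R₁ (tl hd))
  ... | inj₁ a′ with Adj-quadruple a′
  ...   | inj₁ (_ , e₂) = ⊥-elim (y≢ x⁻¹∈w e₂)
  ...   | inj₂ (inj₁ (_ , e₂)) = ⊥-elim (y≢ b⁻¹∈w e₂)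
  ...   | inj₂ (inj₂ (_ , e₂)) = ⊥-elim (y≢ c⁻¹∈w e₂)
  b·y′ | inj₂ c′ = c′
  y·a⁻¹′ : CycAdj y (inv a) w′
  y·a⁻¹′ with forth₂ (CycAdj-Replace⁺ R₁ (tl (tl hd)))
  ... | inj₁ a′ with Adj-quadruple a′
  ...   | inj₁ (e₁ , _) = ⊥-elim (y≢ c∈w e₁)
  ...   | inj₂ (inj₁ (e₁ , _)) = ⊥-elim (y≢ x⁻¹∈w e₁)
  ...   | inj₂ (inj₂ (e₁ , _)) = ⊥-elim (y≢ b⁻¹∈w e₁)
  y·a⁻¹′ | inj₂ c′ = c′
  c·b⁻¹′ : CycAdj c (inv b) w′
  c·b⁻¹′ = CycAdj-Replace⁺ R₂ hd
  b⁻¹·y⁻¹′ : CycAdj (inv b) (inv y) w′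
  b⁻¹·y⁻¹′ = CycAdj-Replace⁺ R₂ (tl hd)
  y⁻¹·c⁻¹′ : CycAdj (inv y) (inv c) w′
  y⁻¹·c⁻¹′ = CycAdj-Replace⁺ R₂ (tl (tl hd))

  Ps : List (Letter × Letter)
  Ps = (a , x) ∷ (x , b) ∷ (b , inv a) ∷ (c , inv x) ∷ (inv x , inv b) ∷ (inv b , inv c) ∷ []

  Ps⊆w : ∀ {p q} → (p , q) ∈ Ps → CycAdj p q w
  Ps⊆w (here refl) = a·x
  Ps⊆w (there (here refl)) = x·b
  Ps⊆w (there (there (here refl))) = b·a⁻¹
  Ps⊆w (there (there (there (here refl)))) = c·x⁻¹
  Ps⊆w (there (there (there (there (here refl))))) = x⁻¹·b⁻¹
  Ps⊆w (there (there (there (there (there (here refl)))))) = b⁻¹·c⁻¹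

  Ps↦w′ : ∀ {p q} → (p , q) ∈ Ps → CycAdj (cycle₃ b x y p) (cycle₃ b x y q) w′
  Ps↦w′ (here refl) = CycAdj-resp fix-a cycle-x a·b′
  Ps↦w′ (there (here refl)) = CycAdj-resp cycle-x cycle-s b·y′
  Ps↦w′ (there (there (here refl))) = CycAdj-resp cycle-s (cycle-inv fix-a) y·a⁻¹′
  Ps↦w′ (there (there (there (here refl)))) = CycAdj-resp fix-c (cycle-inv cycle-x) c·b⁻¹′
  Ps↦w′ (there (there (there (there (here refl))))) = CycAdj-resp (cycle-inv cycle-x) (cycle-inv cycle-s) b⁻¹·y⁻¹′
  Ps↦w′ (there (there (there (there (there (here refl)))))) = CycAdj-resp (cycle-inv cycle-s) (cycle-inv fix-c) y⁻¹·c⁻¹′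

  u₁⊆Ps : ∀ {p q} → Adj (a ∷ x ∷ b ∷ inv a ∷ []) p q → (p , q) ∈ Ps
  u₁⊆Ps a′ with Adj-quadruple a′
  ... | inj₁ (refl , refl) = here refl
  ... | inj₂ (inj₁ (refl , refl)) = there (here refl)
  ... | inj₂ (inj₂ (refl , refl)) = there (there (here refl))

  u₂⊆Ps : ∀ {p q} → Adj (c ∷ inv x ∷ inv b ∷ inv c ∷ []) p q → (p , q) ∈ Ps
  u₂⊆Ps a′ with Adj-quadruple a′
  ... | inj₁ (refl , refl) = there (there (there (here refl)))
  ... | inj₂ (inj₁ (refl , refl)) = there (there (there (there (here refl))))
  ... | inj₂ (inj₂ (refl , refl)) = there (there (there (there (there (here refl)))))

  heads : ∀ {m} → m ∈ b ∷ x ∷ inv b ∷ inv x ∷ [] → ∃[ q ] (m , q) ∈ Ps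
  heads (here refl) = inv a , there (there (here refl))
  heads (there (here refl)) = b , there (here refl)
  heads (there (there (here refl))) = inv c , there (there (there (there (there (here refl)))))
  heads (there (there (there (here refl)))) = inv b , there (there (there (there (here refl))))

  tails : ∀ {m} → m ∈ b ∷ x ∷ inv b ∷ inv x ∷ [] → ∃[ p ] (p , m) ∈ Ps
  tails (here refl) = x , there (here refl)
  tails (there (here refl)) = a , here refl
  tails (there (there (here refl))) = inv x , there (there (there (there (here refl))))
  tails (there (there (there (here refl)))) = c , there (there (there (here refl)))

  removed inserted : Word
  removed = a ∷ x ∷ b ∷ inv a ∷ c ∷ inv x ∷ inv b ∷ inv c ∷ []
  inserted = a ∷ b ∷ y ∷ inv a ∷ c ∷ inv b ∷ inv y ∷ inv c ∷ []

  occ-exchange : ∀ l → occ l w′ + (δ l x + δ l (inv x)) ≡ occ l w + (δ l y + δ l (inv y))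
  occ-exchange = occ-trade w w′ x y removed inserted (λ l → Occ.μ-Replace₂ l R₁ R₂) λ l →
    solve 10 (λ A X B A⁻ C X⁻ B⁻ C⁻ Y Y⁻ →
       (A :+ (B :+ (Y :+ (A⁻ :+ (C :+ (B⁻ :+ (Y⁻ :+ (C⁻ :+ con 0)))))))) :+ (X :+ X⁻)
       := (A :+ (X :+ (B :+ (A⁻ :+ (C :+ (X⁻ :+ (B⁻ :+ (C⁻ :+ con 0)))))))) :+ (Y :+ Y⁻))
       refl (δ l a) (δ l x) (δ l b) (δ l (inv a)) (δ l c) (δ l (inv x)) (δ l (inv b)) (δ l (inv c))
            (δ l y) (δ l (inv y))

  length-w′ : length w′ ≡ length w
  length-w′ = sym (+-cancelʳ-≡ 8 (length w) (length w′) (Length.μ-Replace₂ R₁ R₂))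

  open Type2 g w w₁ w′ b x y MW x∈w fresh b∈w b≢x b≢x⁻¹ _ _ forth₁ forth₂ Ps Ps⊆w Ps↦w′ u₁⊆Ps u₂⊆Ps heads tails
    (LetterExchange.dist′ w w′ x y dist inv∈ x∈w fresh occ-exchange) length-w′ public using (equivalent; maximal)

lemma2p1 : (g : ℕ) (w : Word) (x y : Letter) (w' : Word) →
           MaxWicks g w → x ∈ w → Fresh y w → IH w x y w' →
           MaxWicks g w' × (IHType2 w x y w' → Equivalent w' w)
lemma2p1 g w x y w′ MW x∈w fresh ih = maximal ih , equivalent
  where
  equivalent : IHType2 w x y w′ → Equivalent w′ w
  equivalent (inj₁ (a , b , d , w₁ , axb , a⁻¹x⁻¹d , R₁ , R₂)) =
    Type2a.equivalent g w w′ x y MW x∈w fresh a b d w₁ axb a⁻¹x⁻¹d R₁ R₂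
  equivalent (inj₂ (a , b , c , w₁ , axb , cx⁻¹b⁻¹ , R₁ , R₂)) =
    Type2b.equivalent g w w′ x y MW x∈w fresh a b c w₁ axb cx⁻¹b⁻¹ R₁ R₂
  maximal : IH w x y w′ → MaxWicks g w′
  maximal (inj₁ (a , b , c , d , w₁ , w₂ , w₃ , axb , cx⁻¹d , _ , _ , R₁ , R₂ , R₃ , R₄)) =
    Type1.maximal g w w′ x y MW x∈w fresh a b c d w₁ w₂ w₃ axb cx⁻¹d R₁ R₂ R₃ R₄
  maximal (inj₂ (inj₁ (a , b , d , w₁ , axb , a⁻¹x⁻¹d , R₁ , R₂))) =
    Type2a.maximal g w w′ x y MW x∈w fresh a b d w₁ axb a⁻¹x⁻¹d R₁ R₂
  maximal (inj₂ (inj₂ (a , b , c , w₁ , axb , cx⁻¹b⁻¹ , R₁ , R₂))) =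
    Type2b.maximal g w w′ x y MW x∈w fresh a b c w₁ axb cx⁻¹b⁻¹ R₁ R₂
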